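{- Let $n\geq1$, $d\geq 0$, let $c\in\mathsf{SortedRec}(S_{n,d})$ and let $w=\mu\circ\phi^{ -1}(c)\in\mathsf{Schr\ddot{o}der}_{n,d}$. Then $\mathsf{area}(w)=\mathsf{level}(c)$ and $\mathsf{bounce}^{\mathsf{Sch}}(w)=\mathsf{wtopple}_{ITC}(c)-(n+d)$.
   Context: The complete split graph $S_{n,d}$ has vertices $s,v_1,\ldots,v_n$ and $w_1,\ldots,w_d$; any two distinct vertices among $s,v_1,\ldots,v_n$ are adjacent, each $w_j$ is adjacent to each of $s,v_1,\ldots,v_n$, and no two $w_j$'s are adjacent; $s$ is the sink, $\deg(v_i)=n+d$, $\deg(w_j)=n+1$. A configuration assigns non-negative integers to non-sink vertices, written $(c(v_1),\ldots,c(v_n);c(w_1),\ldots,c(w_d))$. A non-sink vertex $v$ is unstable if $c(v)\geq \deg(v)$; toppling $v$ removes $\deg(v)$ grains from $v$ (if $v\ne s$) and adds one grain to each non-sink neighbour. A stable configuration $c$ is recurrent iff there is an ordering $s=u_0,u_1,\ldots,u_{n+d}$ of all vertices such that starting from $c$ and toppling $u_0,\ldots,u_{i-1}$ in turn makes $u_i$ unstable for every $i\ge1$. $\mathsf{SortedRec}(S_{n,d})$: recurrent configurations with $c(v_1)\ge\cdots\ge c(v_n)$, $c(w_1)\ge\cdots\ge c(w_d)$. $\mathsf{height}(c)$ is the sum of all entries and $\mathsf{level}(c)=\mathsf{height}(c)-\left(\binom{n+d}{2}-\binom{d}{2}\right)$. ITC toppling of $c$: topple the sink; then for $i=1,2,\ldots$: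 topple simultaneously the set $Q'_i$ of currently unstable independent vertices, then topple simultaneously the set $P'_i$ of currently unstable clique vertices; stop after the first $i=k$ at which the configuration is stable. $\mathsf{wtopple}_{ITC}(c)=\sum_{i=1}^k i(|Q'_i|+|P'_i|)$. $\mathsf{Schr\ddot{o}der}_{n,d}$ is the set of words with $n$ letters $U$, $n$ letters $D$, $d$ letters $H$ such that every prefix has at most as many $D$'s as $U$'s. For such $p$, $\phi(p)=(a_1,\ldots,a_n;b_1,\ldots,b_d)$ where $b_i$ is the number of $D$'s after the $i$th $H$ and $a_j+1$ is the number of non-$U$ letters after the $j$th $U$; $\phi$ is a bijection $\mathsf{Schr\ddot{o}der}_{n,d}\to\mathsf{SortedRec}(S_{n,d})$. The mirror map is $\mu(x_1\cdots x_m)=\mu(x_m)\cdots\mu(x_1)$ with $\mu(U)=D$, $\mu(H)=H$, $\mu(D)=U$. A word $w$ is drawn as a lattice path from $(0,0)$ with $U=(0,1)$, $H=(1,1)$, $D=(1,0)$. $\mathsf{area}(w)$ is the number of triangles with vertex set $\{(i,j),(i+1,j),(i+1,j+1)\}$ ($i,j$ integers) lying between the path and the line $y=x$. Let $C(w)$ be the Dyck path from $(0,0)$ to $(n,n)$ obtained by deleting the $H$ letters. The bounce path of $C(w)$ starts at $(n,n)$ and repeats: move west until reaching the leftmost point of $C(w)$ at the current height (the top endpoint of a $U$ step of $C(w)$), then move south until reaching the line $y=x$; until $(0,0)$ is reached. $\mathrm{bounce}(C(w))$ is the sum of the $x$-coordinates of the points (other than $(n,n)$) at which the bounce path meets $y=x$.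 The $U$ steps of $C(w)$ whose top endpoints are the points where the bounce path turns from west to south correspond to $U$ steps of $w$, called the peaks of $w$. For each $H$ step $\alpha$ of $w$, $b(\alpha)$ is the number of peaks of $w$ whose top endpoint has $y$-coordinate at least the $y$-coordinate of the upper endpoint of $\alpha$. Then $\mathsf{bounce}^{\mathsf{Sch}}(w)=\mathrm{bounce}(C(w))+\sum_\alpha b(\alpha)$, the sum over all $H$ steps of $w$. -}

module Defs where

open import Data.Bool using (Bool; true; false; if_then_else_; _∧_; not)
open import Data.Nat using (ℕ; zero; suc; _+_; _*_; _∸_; _≤_; _<_; _≤ᵇ_; _≡ᵇ_)
open import Data.Nat.Combinatorics using (_C_)
open import Data.Integer using (ℤ; +_; _-_)
open import Data.Fin using (Fin) renaming (_≤_ to _≤F_)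
import Data.Fin as F
open import Data.List using (List; []; _∷_; _++_; map; reverse; filter; length; allFin)
import Data.List as L
open import Data.Nat.ListAction using () renaming (sum to lsum)
open import Data.Vec using (Vec; lookup; tabulate; toList)
import Data.Vec as V
open import Data.Product using (_×_; _,_; proj₁; proj₂; Σ)
open import Data.Unit using (⊤)
open import Relation.Nullary using (¬_; does)
open import Data.List.Relation.Binary.Permutation.Propositional using (_↭_)

countB : {A : Set} → (A → Bool) → List A → ℕ
countB p []       = 0
countB p (x ∷ xs) = (if p x then 1 else 0) + countB p xs

-- The complete split graph S_{n,d}
-- Non-sink vertices: clique vertices v_1..v_n  (cl i)  and
-- independent vertices w_1..w_d  (ind j).  The sink s is treated separately.

data NS (n d : ℕ) : Set where
  cl  : Fin n → NS n d
  ind : Fin d → NS n d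

allNS : (n d : ℕ) → List (NS n d)
allNS n d = map cl (allFin n) ++ map ind (allFin d)

deg : {n d : ℕ} → NS n d → ℕ
deg {n} {d} (cl _)  = n + d
deg {n} {d} (ind _) = n + 1

-- adjacency between non-sink vertices (every non-sink vertex is also
-- adjacent to the sink)
adj : {n d : ℕ} → NS n d → NS n d → Bool
adj (cl i)  (cl j)  = not (does (i F.≟ j))
adj (cl _)  (ind _) = true
adj (ind _) (cl _)  = true
adj (ind _) (ind _) = false

eqNS : {n d : ℕ} → NS n d → NS n d → Bool
eqNS (cl i)  (cl j)  = does (i F.≟ j)
eqNS (ind i) (ind j) = does (i F.≟ j)
eqNS _ _ = false

isCl : {n d : ℕ} → NS n d → Bool
isCl (cl _)  = true
isCl (ind _) = false

isInd : {n d : ℕ} → NS n d → Bool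
isInd v = not (isCl v)

Cfg : ℕ → ℕ → Set
Cfg n d = Vec ℕ n × Vec ℕ d

val : {n d : ℕ} → Cfg n d → NS n d → ℕ
val c (cl i)  = lookup (proj₁ c) i
val c (ind j) = lookup (proj₂ c) j

Unstable : {n d : ℕ} → Cfg n d → NS n d → Set
Unstable c v = deg v ≤ val c v

unstableB : {n d : ℕ} → Cfg n d → NS n d → Bool
unstableB c v = deg v ≤ᵇ val c v

Stable : {n d : ℕ} → Cfg n d → Set
Stable c = ∀ v → val c v < deg v

toppleSink : {n d : ℕ} → Cfg n d → Cfg n d
toppleSink (a , b) = V.map suc a , V.map suc b

toppleSet : {n d : ℕ} → (NS n d → Bool) → Cfg n d → Cfg n d
toppleSet {n} {d} S c = tabulate (λ i → new (cl i)) , tabulate (λ j → new (ind j))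
  where
  new : NS n d → ℕ
  new v = (val c v ∸ (if S v then deg v else 0))
          + countB (λ u → S u ∧ adj u v) (allNS n d)

topple1 : {n d : ℕ} → NS n d → Cfg n d → Cfg n d
topple1 u = toppleSet (eqNS u)

ValidSeq : {n d : ℕ} → Cfg n d → List (NS n d) → Set
ValidSeq c []       = ⊤
ValidSeq c (u ∷ us) = Unstable c u × ValidSeq (topple1 u c) us

Recurrent : {n d : ℕ} → Cfg n d → Set
Recurrent {n} {d} c =
  Stable c × Σ (List (NS n d)) (λ us → (us ↭ allNS n d) × ValidSeq (toppleSink c) us)

Decreasing : {m : ℕ} → Vec ℕ m → Set
Decreasing a = ∀ i j → i ≤F j → lookup a j ≤ lookup a i

SortedRec : {n d : ℕ} → Cfg n d → Set
SortedRec c = Recurrent c × Decreasing (proj₁ c) × Decreasing (proj₂ c)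

height : {n d : ℕ} → Cfg n d → ℕ
height (a , b) = V.sum a + V.sum b

level : {n d : ℕ} → Cfg n d → ℤ
level {n} {d} c = + height c - (+ ((n + d) C 2) - + (d C 2))

itcRound : {n d : ℕ} → Cfg n d → Cfg n d × ℕ
itcRound {n} {d} c = c₂ , (q + p)
  where
  Q : NS n d → Bool
  Q v = isInd v ∧ unstableB c v
  c₁ = toppleSet Q c
  P : NS n d → Bool
  P v = isCl v ∧ unstableB c₁ v
  c₂ = toppleSet P c₁
  q = countB Q (allNS n d)
  p = countB P (allNS n d)

itcConf : {n d : ℕ} → Cfg n d → ℕ → Cfg n d
itcConf c zero    = toppleSink c
itcConf c (suc i) = proj₁ (itcRound (itcConf c i))

itcWeight : {n d : ℕ} → Cfg n d → ℕ → ℕ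
itcWeight c zero    = 0
itcWeight c (suc k) = itcWeight c k + suc k * proj₂ (itcRound (itcConf c k))

ITCStopsAt : {n d : ℕ} → Cfg n d → ℕ → Set
ITCStopsAt c k = (1 ≤ k) × Stable (itcConf c k)
               × (∀ i → 1 ≤ i → i < k → ¬ Stable (itcConf c i))

data Step : Set where
  U D H : Step

isU isD isH : Step → Bool
isU U = true
isU _ = false
isD D = true
isD _ = false
isH H = true
isH _ = false

-- every prefix has at most as many D's as U's (tracked via U-count minus
-- D-count so far)
PrefixOK : ℕ → List Step → Set
PrefixOK k []       = ⊤
PrefixOK k (U ∷ xs) = PrefixOK (suc k) xs
PrefixOK k (H ∷ xs) = PrefixOK k xs
PrefixOK k (D ∷ xs) = (1 ≤ k) × PrefixOK (k ∸ 1) xs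

Schroder : ℕ → ℕ → List Step → Set
Schroder n d w = (countB isU w ≡' n) × (countB isD w ≡' n) × (countB isH w ≡' d)
               × PrefixOK 0 w
  where
  open import Relation.Binary.PropositionalEquality renaming (_≡_ to _≡'_)

phiA : List Step → List ℕ
phiA []       = []
phiA (U ∷ xs) = (countB (λ s → not (isU s)) xs ∸ 1) ∷ phiA xs
phiA (_ ∷ xs) = phiA xs

phiB : List Step → List ℕ
phiB []       = []
phiB (H ∷ xs) = countB isD xs ∷ phiB xs
phiB (_ ∷ xs) = phiB xs

φ : List Step → List ℕ × List ℕ
φ p = phiA p , phiB p

μStep : Step → Step
μStep U = D
μStep H = H
μStep D = U

μ : List Step → List Step
μ w = reverse (map μStep w)

annot : ℕ → ℕ → ℕ → List Step → List (Step × ℕ × ℕ × ℕ)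
annot u dd h []       = []
annot u dd h (U ∷ xs) = (U , u , dd , h) ∷ annot (suc u) dd h xs
annot u dd h (D ∷ xs) = (D , u , dd , h) ∷ annot u (suc dd) h xs
annot u dd h (H ∷ xs) = (H , u , dd , h) ∷ annot u dd (suc h) xs

-- The triangle {(i,j),(i+1,j),(i+1,j+1)} lies under the non-U step
-- starting at (i,y) in column [i,i+1]:
--   D step (to (i+1,y))   : j + 1 ≤ y
--   H step (to (i+1,y+1)) : j ≤ y
-- and it lies above the line y = x iff i + 1 ≤ j.
triInCol : Step → ℕ → ℕ → ℕ → Bool
triInCol U i y j = false
triInCol D i y j = (suc i ≤ᵇ j) ∧ (suc j ≤ᵇ y)
triInCol H i y j = (suc i ≤ᵇ j) ∧ (j ≤ᵇ y)

-- area: number of such triangles between the path and y = x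
-- (every column i contains exactly one non-U step; all relevant j are
-- below the path's maximal height length w)
area : List Step → ℕ
area w = lsum (map col (annot 0 0 0 w))
  where
  col : Step × ℕ × ℕ × ℕ → ℕ
  col (s , u , dd , h) = countB (triInCol s (dd + h) (u + h)) (L.upTo (suc (length w)))

dyck : List Step → List Step
dyck w = L.filterᵇ (λ s → not (isH s)) w

-- x-coordinate of the top endpoint of the y-th U step (y ≥ 1) of a path,
-- i.e. the number of D (and H) steps before it, starting from (x, cur)
xTopU : ℕ → ℕ → ℕ → List Step → ℕ
xTopU x cur y []       = 0
xTopU x cur y (U ∷ xs) = if suc cur ≡ᵇ y then x else xTopU x (suc cur) y xs
xTopU x cur y (D ∷ xs) = xTopU (suc x) cur y xs
xTopU x cur y (H ∷ xs) = xTopU (suc x) cur y xs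

hBeforeU : ℕ → ℕ → ℕ → List Step → ℕ
hBeforeU h cur y []       = 0
hBeforeU h cur y (U ∷ xs) = if suc cur ≡ᵇ y then h else hBeforeU h (suc cur) y xs
hBeforeU h cur y (D ∷ xs) = hBeforeU h cur y xs
hBeforeU h cur y (H ∷ xs) = hBeforeU (suc h) cur y xs

-- heights y_0 = n > y_1 > ... ≥ 1 of the turning points of the bounce path
-- of the Dyck path C (these are the heights of the peaks); after turning
-- at height y the path meets the diagonal at (x,x) with x = xTopU 0 0 y C.
-- The fuel bounds the number of turning points (it strictly decreases,
-- so length C suffices).
bounceHeights : List Step → ℕ → ℕ → List ℕ
bounceHeights Cp zero    y       = []
bounceHeights Cp (suc f) zero    = []
bounceHeights Cp (suc f) (suc y) = suc y ∷ bounceHeights Cp f (xTopU 0 0 (suc y) Cp)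

peakHeightsC : List Step → List ℕ
peakHeightsC w = bounceHeights (dyck w) (length w) (countB isU w)

-- bounce(C(w)): sum of x-coordinates of the diagonal touch points other
-- than (n,n)
bounceC : List Step → ℕ
bounceC w = lsum (map (λ y → xTopU 0 0 y (dyck w)) (peakHeightsC w))

-- y-coordinates (in w) of the top endpoints of the peaks of w
peakYs : List Step → List ℕ
peakYs w = map (λ y → y + hBeforeU 0 0 y w) (peakHeightsC w)

-- Σ over H steps α of b(α); the upper endpoint of an H step with u U's and
-- h H's before it has y-coordinate u + h + 1
sumB : List Step → ℕ
sumB w = lsum (map bα (annot 0 0 0 w))
  where
  bα : Step × ℕ × ℕ × ℕ → ℕ
  bα (H , u , dd , h) = countB (λ py → suc (u + h) ≤ᵇ py) (peakYs w)
  bα _ = 0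

bounceSch : List Step → ℕ
bounceSch w = bounceC w + sumB w

module Submission where

-- Let w = μ p and let X z, H z count the D and H steps of w before its z-th U step.
-- Through φ, exactly n − X z clique vertices satisfy a_i + 1 ≥ z + H z and exactly d − H z
-- independent vertices satisfy b_j ≥ z. ITC toppling keeps the vertices toppled so far equal
-- to those passing the threshold z, and each round moves the threshold from z to X z (first
-- the independent vertices, then the clique vertices). Hence round r topples
-- R (z_{r-1}) − R (z_r) vertices, where R = X + H and z_r is the r-th iterate of X from n + 1,
-- and Abel summation gives wtopple = Σ_r R (z_r). The bounce path of C(w) turns at the
-- heights z_1 = n, z_2 = X n, … and meets the diagonal at X (z_r), while the b(α) summed
-- over the H steps count H (z_r) for each peak; so bounce^Sch(w) = Σ_{r≥1} R (z_r).
-- For the area, the triangles in the column of a non-U step number its contribution to the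
-- height of c minus an offset, and the offsets add up to C(n+d,2) − C(d,2).

open import Defs
open import Data.Bool using (Bool; true; false; if_then_else_; _∧_; _∨_; not; T)
open import Data.Bool.Properties using (∧-zeroʳ; ∧-identityʳ; ∨-identityʳ; ∧-distribʳ-∨)
open import Data.Empty using (⊥; ⊥-elim)
open import Data.Fin using (Fin; zero; suc)
import Data.Fin as Fin
import Data.Integer as ℤ
open import Data.Integer.Properties using (pos-+)
import Data.Integer.Tactic.RingSolver as ℤ-Solver
open import Data.List using (List; []; _∷_; _++_; map; reverse; length; allFin; upTo)
open import Data.List.Properties using (unfold-reverse; reverse-map; map-cong; map-cong-local; map-id; upTo-∷ʳ)
open import Data.List.Relation.Binary.Permutation.Propositional using (↭-sym)
open import Data.List.Relation.Binary.Permutation.Propositional.Properties using (↭-reverse; All-resp-↭)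
open import Data.List.Relation.Unary.All as All using (All; []; _∷_)
open import Data.Nat
open import Data.Nat.Combinatorics using (_C_; nCk+nC[k+1]≡[n+1]C[k+1]; nC1≡n)
open import Data.Nat.GeneralisedArithmetic using (fold; iterate; iterate-is-fold)
open import Data.Nat.ListAction using (sum)
open import Data.Nat.ListAction.Properties using (sum-↭)
open import Data.Nat.Properties
open import Data.Nat.Tactic.RingSolver using (solve-∀)
open import Data.Product using (_×_; _,_; proj₁; proj₂; Σ) renaming (map to Σ-map)
open import Data.Unit using (⊤; tt)
open import Data.Vec using (Vec; lookup; tabulate; toList)
import Data.Vec as V
open import Data.Vec.Properties using (lookup∘tabulate; tabulate-cong; tabulate∘lookup; lookup-map)
open import Function using (_∘_; case_of_)
open import Relation.Binary.PropositionalEquality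
open import Relation.Nullary using (¬_; does; yes; no; Dec)
open import Relation.Nullary.Decidable using (dec-true; dec-false)
open import Algebra.Properties.CommutativeSemigroup +-commutativeSemigroup using (interchange)

bit : Bool → ℕ
bit b = if b then 1 else 0

≤ᵇ-true : ∀ {m n} → m ≤ n → (m ≤ᵇ n) ≡ true
≤ᵇ-true {m} {n} = dec-true (m ≤? n)

≤ᵇ-false : ∀ {m n} → ¬ m ≤ n → (m ≤ᵇ n) ≡ false
≤ᵇ-false {m} {n} = dec-false (m ≤? n)

≤ᵇ-sound : ∀ {m n} → (m ≤ᵇ n) ≡ true → m ≤ n
≤ᵇ-sound {m} {n} e = ≤ᵇ⇒≤ m n (subst T (sym e) tt)

≡ᵇ-true : ∀ {m n} → m ≡ n → (m ≡ᵇ n) ≡ true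
≡ᵇ-true {m} {n} = dec-true (m ≟ n)

≡ᵇ-false : ∀ {m n} → m ≢ n → (m ≡ᵇ n) ≡ false
≡ᵇ-false {m} {n} = dec-false (m ≟ n)

not-<ᵇ : ∀ m n → not (suc m ≤ᵇ n) ≡ (n ≤ᵇ m)
not-<ᵇ m n with m <? n
... | yes m<n = trans (cong not (≤ᵇ-true m<n)) (sym (≤ᵇ-false (<⇒≱ m<n)))
... | no m≮n  = trans (cong not (≤ᵇ-false m≮n)) (sym (≤ᵇ-true (≮⇒≥ m≮n)))

∧-true-right : ∀ a {b} → a ∧ b ≡ true → b ≡ true
∧-true-right true q = q

bool-ext : ∀ {a b : Bool} → (a ≡ true → b ≡ true) → (b ≡ true → a ≡ true) → a ≡ b
bool-ext {false} {false} f g = refl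
bool-ext {false} {true}  f g = g refl
bool-ext {true}  {false} f g = sym (f refl)
bool-ext {true}  {true}  f g = refl

if-true : ∀ {A : Set} {b : Bool} {x y : A} → b ≡ true → (if b then x else y) ≡ x
if-true refl = refl

if-false : ∀ {A : Set} {b : Bool} {x y : A} → b ≡ false → (if b then x else y) ≡ y
if-false refl = refl

module _ {A : Set} where

  countB-++ : (p : A → Bool) (xs ys : List A) → countB p (xs ++ ys) ≡ countB p xs + countB p ys
  countB-++ p []       ys = refl
  countB-++ p (x ∷ xs) ys = trans (cong (bit (p x) +_) (countB-++ p xs ys)) (sym (+-assoc (bit (p x)) _ _))

  countB-cong : {p q : A → Bool} → (∀ x → p x ≡ q x) → (xs : List A) → countB p xs ≡ countB q xs
  countB-cong e []       = refl
  countB-cong e (x ∷ xs) = cong₂ (λ b r → bit b + r) (e x) (countB-cong e xs)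

  countB-cong-local : {p q : A → Bool} {xs : List A} → All (λ x → p x ≡ q x) xs → countB p xs ≡ countB q xs
  countB-cong-local []       = refl
  countB-cong-local (e ∷ es) = cong₂ (λ b r → bit b + r) e (countB-cong-local es)

  countB-false : (xs : List A) → countB (λ _ → false) xs ≡ 0
  countB-false []       = refl
  countB-false (_ ∷ xs) = countB-false xs

  countB-≤-length : (p : A → Bool) (xs : List A) → countB p xs ≤ length xs
  countB-≤-length p [] = z≤n
  countB-≤-length p (x ∷ xs) with p x
  ... | true  = s≤s (countB-≤-length p xs)
  ... | false = m≤n⇒m≤1+n (countB-≤-length p xs)

  countB-mono : {p q : A → Bool} → (∀ x → p x ≡ true → q x ≡ true) → (xs : List A) → countB p xs ≤ countB q xs
  countB-mono f [] = z≤n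
  countB-mono {p} {q} f (x ∷ xs) = +-mono-≤ (bit-mono (f x)) (countB-mono f xs)
    where
    bit-mono : {a b : Bool} → (a ≡ true → b ≡ true) → bit a ≤ bit b
    bit-mono {false} _ = z≤n
    bit-mono {true}  g rewrite g refl = ≤-refl

  countB-map : {B : Set} (p : B → Bool) (f : A → B) (xs : List A) → countB p (map f xs) ≡ countB (p ∘ f) xs
  countB-map p f []       = refl
  countB-map p f (x ∷ xs) = cong (bit (p (f x)) +_) (countB-map p f xs)

  countB≡sum : (p : A → Bool) (xs : List A) → countB p xs ≡ sum (map (bit ∘ p) xs)
  countB≡sum p []       = refl
  countB≡sum p (x ∷ xs) = cong (bit (p x) +_) (countB≡sum p xs)

  sum-map-reverse : (f : A → ℕ) (xs : List A) → sum (map f (reverse xs)) ≡ sum (map f xs)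
  sum-map-reverse f xs = trans (cong sum (reverse-map f xs)) (sum-↭ (↭-reverse (map f xs)))

  countB-reverse : (p : A → Bool) (xs : List A) → countB p (reverse xs) ≡ countB p xs
  countB-reverse p xs = begin
    countB p (reverse xs)           ≡⟨ countB≡sum p (reverse xs) ⟩
    sum (map (bit ∘ p) (reverse xs)) ≡⟨ sum-map-reverse (bit ∘ p) xs ⟩
    sum (map (bit ∘ p) xs)           ≡⟨ countB≡sum p xs ⟨
    countB p xs                      ∎
    where open ≡-Reasoning

  countB-∨ : (p q : A → Bool) → (∀ x → p x ∧ q x ≡ false) → (xs : List A) →
             countB (λ x → p x ∨ q x) xs ≡ countB p xs + countB q xs
  countB-∨ p q disj [] = refl
  countB-∨ p q disj (x ∷ xs) with p x | q x | disj x
  ... | true  | true  | ()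
  ... | true  | false | _ = cong suc (countB-∨ p q disj xs)
  ... | false | true  | _ = trans (cong suc (countB-∨ p q disj xs)) (sym (+-suc (countB p xs) _))
  ... | false | false | _ = countB-∨ p q disj xs

  countB-∧-split : (p q : A → Bool) (xs : List A) →
    countB (λ x → p x ∧ q x) xs + countB (λ x → p x ∧ not (q x)) xs ≡ countB p xs
  countB-∧-split p q [] = refl
  countB-∧-split p q (x ∷ xs) with p x | q x
  ... | true  | true  = cong suc (countB-∧-split p q xs)
  ... | true  | false = trans (+-suc _ _) (cong suc (countB-∧-split p q xs))
  ... | false | _     = countB-∧-split p q xs

  sum-map-zero : (xs : List A) → sum (map (λ _ → 0) xs) ≡ 0
  sum-map-zero []       = refl
  sum-map-zero (_ ∷ xs) = sum-map-zero xs

  sum-map-+ : (f g : A → ℕ) (xs : List A) → sum (map f xs) + sum (map g xs) ≡ sum (map (λ x → f x + g x) xs)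
  sum-map-+ f g []       = refl
  sum-map-+ f g (x ∷ xs) = trans (interchange (f x) _ (g x) _) (cong (f x + g x +_) (sum-map-+ f g xs))

  sum-map-if-bit : (p q : A → Bool) (xs : List A) →
    sum (map (λ x → if p x then bit (q x) else 0) xs) ≡ countB (λ x → p x ∧ q x) xs
  sum-map-if-bit p q [] = refl
  sum-map-if-bit p q (x ∷ xs) with p x
  ... | true  = cong (bit (q x) +_) (sum-map-if-bit p q xs)
  ... | false = sum-map-if-bit p q xs

sum-map-swap : {A B : Set} (F : A → B → ℕ) (xs : List A) (ys : List B) →
  sum (map (λ x → sum (map (F x) ys)) xs) ≡ sum (map (λ y → sum (map (λ x → F x y) xs)) ys)
sum-map-swap F []       ys = sym (sum-map-zero ys)
sum-map-swap F (x ∷ xs) ys = begin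
  sum (map (F x) ys) + sum (map (λ x′ → sum (map (F x′) ys)) xs)
    ≡⟨ cong (sum (map (F x) ys) +_) (sum-map-swap F xs ys) ⟩
  sum (map (F x) ys) + sum (map (λ y → sum (map (λ x′ → F x′ y) xs)) ys)
    ≡⟨ sum-map-+ (F x) _ ys ⟩
  sum (map (λ y → F x y + sum (map (λ x′ → F x′ y) xs)) ys) ∎
  where open ≡-Reasoning

countFin : {n : ℕ} → (Fin n → Bool) → ℕ
countFin {zero}  P = 0
countFin {suc n} P = bit (P zero) + countFin (P ∘ suc)

countB-tabulate : {A : Set} {n : ℕ} (p : A → Bool) (f : Fin n → A) → countB p (Data.List.tabulate f) ≡ countFin (p ∘ f)
countB-tabulate {n = zero}  p f = refl
countB-tabulate {n = suc n} p f = cong (bit (p (f zero)) +_) (countB-tabulate p (f ∘ suc))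

countB-allFin : (n : ℕ) (P : Fin n → Bool) → countB P (allFin n) ≡ countFin P
countB-allFin n P = countB-tabulate P (λ i → i)

countFin-cong : {n : ℕ} {P Q : Fin n → Bool} → (∀ i → P i ≡ Q i) → countFin P ≡ countFin Q
countFin-cong {zero}  e = refl
countFin-cong {suc n} e = cong₂ (λ b r → bit b + r) (e zero) (countFin-cong (e ∘ suc))

countFin-≤ : {n : ℕ} (P : Fin n → Bool) → countFin P ≤ n
countFin-≤ {zero}  P = z≤n
countFin-≤ {suc n} P with P zero
... | true  = s≤s (countFin-≤ (P ∘ suc))
... | false = m≤n⇒m≤1+n (countFin-≤ (P ∘ suc))

countFin-false : {n : ℕ} (P : Fin n → Bool) → (∀ i → P i ≡ false) → countFin P ≡ 0
countFin-false {zero}  P e = refl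
countFin-false {suc n} P e rewrite e zero = countFin-false (P ∘ suc) (e ∘ suc)

countFin-true : {n : ℕ} (P : Fin n → Bool) → (∀ i → P i ≡ true) → countFin P ≡ n
countFin-true {zero}  P e = refl
countFin-true {suc n} P e rewrite e zero = cong suc (countFin-true (P ∘ suc) (e ∘ suc))

countFin≡n⇒true : {n : ℕ} (P : Fin n → Bool) → countFin P ≡ n → ∀ i → P i ≡ true
countFin≡n⇒true {suc n} P e i with P zero in eq
countFin≡n⇒true {suc n} P e zero    | true = eq
countFin≡n⇒true {suc n} P e (suc i) | true = countFin≡n⇒true (P ∘ suc) (suc-injective e) i
... | false = ⊥-elim (<-irrefl refl (≤-trans (≤-reflexive (sym e)) (countFin-≤ (P ∘ suc))))

countFin≡0⇒false : {n : ℕ} (P : Fin n → Bool) → countFin P ≡ 0 → ∀ i → P i ≡ false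
countFin≡0⇒false {suc n} P e i with P zero in eq
countFin≡0⇒false {suc n} P e zero    | false = eq
countFin≡0⇒false {suc n} P e (suc i) | false = countFin≡0⇒false (P ∘ suc) e i

countFin-<⇒witness : {n : ℕ} (P Q : Fin n → Bool) → countFin Q < countFin P →
                     Σ (Fin n) (λ i → (P i ≡ true) × (Q i ≡ false))
countFin-<⇒witness {zero} P Q ()
countFin-<⇒witness {suc n} P Q lt with P zero in ep | Q zero in eq
... | true  | false = zero , ep , eq
... | true  | true  = Σ-map suc (λ q → q) (countFin-<⇒witness (P ∘ suc) (Q ∘ suc) (≤-pred lt))
... | false | false = Σ-map suc (λ q → q) (countFin-<⇒witness (P ∘ suc) (Q ∘ suc) lt)
... | false | true  = Σ-map suc (λ q → q) (countFin-<⇒witness (P ∘ suc) (Q ∘ suc) (≤-trans (n≤1+n _) lt))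

countFin-lookup : {n : ℕ} (P : ℕ → Bool) (a : Vec ℕ n) → countFin (λ i → P (lookup a i)) ≡ countB P (toList a)
countFin-lookup P V.[]       = refl
countFin-lookup P (x V.∷ a) = cong (bit (P x) +_) (countFin-lookup P a)

countFin-≢ : {n : ℕ} (i : Fin n) → suc (countFin (λ j → not (does (j Fin.≟ i)))) ≡ n
countFin-≢ {suc n} zero    = cong suc (countFin-true _ (λ j → refl))
countFin-≢ {suc n} (suc i) = cong suc (countFin-≢ i)

countB-allNS : {n d : ℕ} (p : NS n d → Bool) →
               countB p (allNS n d) ≡ countFin (λ i → p (cl i)) + countFin (λ j → p (ind j))
countB-allNS {n} {d} p = begin
  countB p (map cl (allFin n) ++ map ind (allFin d))
    ≡⟨ countB-++ p (map cl (allFin n)) (map ind (allFin d)) ⟩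
  countB p (map cl (allFin n)) + countB p (map ind (allFin d))
    ≡⟨ cong₂ _+_ (countB-map p cl (allFin n)) (countB-map p ind (allFin d)) ⟩
  countB (p ∘ cl) (allFin n) + countB (p ∘ ind) (allFin d)
    ≡⟨ cong₂ _+_ (countB-allFin n (p ∘ cl)) (countB-allFin d (p ∘ ind)) ⟩
  countFin (λ i → p (cl i)) + countFin (λ j → p (ind j)) ∎
  where open ≡-Reasoning

sumBelow : ℕ → (ℕ → ℕ) → ℕ
sumBelow zero    F = 0
sumBelow (suc K) F = F 0 + sumBelow K (F ∘ suc)

sumBelow-snoc : ∀ K F → sumBelow (suc K) F ≡ sumBelow K F + F K
sumBelow-snoc zero    F = +-comm (F 0) 0
sumBelow-snoc (suc K) F = trans (cong (F 0 +_) (sumBelow-snoc K (F ∘ suc))) (sym (+-assoc (F 0) _ _))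

sumBelow-cong : ∀ K {F G : ℕ → ℕ} → (∀ r → r < K → F r ≡ G r) → sumBelow K F ≡ sumBelow K G
sumBelow-cong zero    e = refl
sumBelow-cong (suc K) e = cong₂ _+_ (e 0 (s≤s z≤n)) (sumBelow-cong K (λ r lt → e (suc r) (s≤s lt)))

sumBelow-zero : ∀ K F → (∀ r → F r ≡ 0) → sumBelow K F ≡ 0
sumBelow-zero zero    F e = refl
sumBelow-zero (suc K) F e = cong₂ _+_ (e 0) (sumBelow-zero K (F ∘ suc) (e ∘ suc))

sumBelow-truncate : ∀ m K F → (∀ r → m ≤ r → F r ≡ 0) → m ≤ K → sumBelow K F ≡ sumBelow m F
sumBelow-truncate zero    K       F e _         = sumBelow-zero K F (λ r → e r z≤n)
sumBelow-truncate (suc m) (suc K) F e (s≤s m≤K) =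
  cong (F 0 +_) (sumBelow-truncate m K (F ∘ suc) (λ r le → e (suc r) (s≤s le)) m≤K)

sumBelow-+ : ∀ K F G → sumBelow K F + sumBelow K G ≡ sumBelow K (λ r → F r + G r)
sumBelow-+ zero    F G = refl
sumBelow-+ (suc K) F G = trans (interchange (F 0) _ (G 0) _) (cong (F 0 + G 0 +_) (sumBelow-+ K (F ∘ suc) (G ∘ suc)))

leastWitness : (P : ℕ → Set) → (∀ k → Dec (P k)) → ∀ m → P m →
               Σ ℕ (λ k → P k × k ≤ m × (∀ i → i < k → ¬ P i))
leastWitness P P? m pm with P? 0
... | yes p0 = 0 , p0 , z≤n , λ i ()
leastWitness P P? zero    pm | no ¬p0 = ⊥-elim (¬p0 pm)
leastWitness P P? (suc m) pm | no ¬p0 with leastWitness (P ∘ suc) (P? ∘ suc) m pm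
... | k , pk , k≤m , below = suc k , pk , s≤s k≤m , earlier
  where
  earlier : ∀ i → i < suc k → ¬ P i
  earlier zero    _         = ¬p0
  earlier (suc i) (s≤s i<k) = below i i<k

fold-≤-∸ : (X : ℕ → ℕ) → (∀ y → X (suc y) ≤ y) → X 0 ≡ 0 → ∀ y r → fold y X r ≤ y ∸ r
fold-≤-∸ X X< X0 y zero = ≤-refl
fold-≤-∸ X X< X0 y (suc r) with fold y X r | fold-≤-∸ X X< X0 y r
... | zero  | _  = ≤-trans (≤-reflexive X0) z≤n
... | suc m | le = ≤-trans (X< m) (≤-trans (suc[m]≤n⇒m≤pred[n] le) (≤-reflexive (pred[m∸n]≡m∸[1+n] y r)))

iterate-fixed : (X : ℕ → ℕ) → X 0 ≡ 0 → ∀ r → iterate X 0 r ≡ 0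
iterate-fixed X X0 zero    = refl
iterate-fixed X X0 (suc r) = trans (cong (λ y → iterate X y r) X0) (iterate-fixed X X0 r)

Entry : Set
Entry = Step × ℕ × ℕ × ℕ

stepOf : Entry → Step
stepOf (s , _) = s

uBefore hBefore : Entry → ℕ
uBefore (_ , u , _ , _) = u
hBefore (_ , _ , _ , h) = h

isDᵉ isHᵉ : Entry → Bool
isDᵉ e = isD (stepOf e)
isHᵉ e = isH (stepOf e)

entries : List Step → List Entry
entries = annot 0 0 0

#U #D #H : List Step → ℕ
#U = countB isU
#D = countB isD
#H = countB isH

annot-++ : ∀ u d h xs ys →
  annot u d h (xs ++ ys) ≡ annot u d h xs ++ annot (u + #U xs) (d + #D xs) (h + #H xs) ys
annot-++ u d h [] ys rewrite +-identityʳ u | +-identityʳ d | +-identityʳ h = refl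
annot-++ u d h (U ∷ xs) ys rewrite +-suc u (#U xs) = cong ((U , u , d , h) ∷_) (annot-++ (suc u) d h xs ys)
annot-++ u d h (D ∷ xs) ys rewrite +-suc d (#D xs) = cong ((D , u , d , h) ∷_) (annot-++ u (suc d) h xs ys)
annot-++ u d h (H ∷ xs) ys rewrite +-suc h (#H xs) = cong ((H , u , d , h) ∷_) (annot-++ u d (suc h) xs ys)

annot-cons : ∀ x u d h xs → annot u d h (x ∷ xs) ≡
  (x , u , d , h) ∷ annot (u + bit (isU x)) (d + bit (isD x)) (h + bit (isH x)) xs
annot-cons U u d h xs rewrite +-identityʳ d | +-identityʳ h | +-comm u 1 = refl
annot-cons D u d h xs rewrite +-identityʳ u | +-identityʳ h | +-comm d 1 = refl
annot-cons H u d h xs rewrite +-identityʳ d | +-identityʳ u | +-comm h 1 = refl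

countB-annot-stepOf : (q : Step → Bool) → ∀ u d h xs → countB (q ∘ stepOf) (annot u d h xs) ≡ countB q xs
countB-annot-stepOf q u d h []       = refl
countB-annot-stepOf q u d h (U ∷ xs) = cong (bit (q U) +_) (countB-annot-stepOf q (suc u) d h xs)
countB-annot-stepOf q u d h (D ∷ xs) = cong (bit (q D) +_) (countB-annot-stepOf q u (suc d) h xs)
countB-annot-stepOf q u d h (H ∷ xs) = cong (bit (q H) +_) (countB-annot-stepOf q u d (suc h) xs)

μ-cons : ∀ x xs → μ (x ∷ xs) ≡ μ xs ++ μStep x ∷ []
μ-cons x xs = unfold-reverse (μStep x) (map μStep xs)

countB-μ : (q : Step → Bool) (xs : List Step) → countB q (μ xs) ≡ countB (q ∘ μStep) xs
countB-μ q xs = trans (countB-reverse q (map μStep xs)) (countB-map q μStep xs)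

#U-μ : ∀ xs → #U (μ xs) ≡ #D xs
#U-μ xs = trans (countB-μ isU xs) (countB-cong (λ { U → refl ; D → refl ; H → refl }) xs)

#D-μ : ∀ xs → #D (μ xs) ≡ #U xs
#D-μ xs = trans (countB-μ isD xs) (countB-cong (λ { U → refl ; D → refl ; H → refl }) xs)

#H-μ : ∀ xs → #H (μ xs) ≡ #H xs
#H-μ xs = trans (countB-μ isH xs) (countB-cong (λ { U → refl ; D → refl ; H → refl }) xs)

-- The entry of μ p contributed by the letter x of p = ys ++ x ∷ xs, computed from the suffix xs.
suffixEntries : List Step → List Entry
suffixEntries []       = []
suffixEntries (x ∷ xs) = (μStep x , #D xs , #U xs , #H xs) ∷ suffixEntries xs

entries-μ : ∀ p → entries (μ p) ≡ reverse (suffixEntries p)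
entries-μ [] = refl
entries-μ (x ∷ xs) = begin
  entries (μ (x ∷ xs))
    ≡⟨ cong entries (μ-cons x xs) ⟩
  entries (μ xs ++ μStep x ∷ [])
    ≡⟨ annot-++ 0 0 0 (μ xs) _ ⟩
  entries (μ xs) ++ annot (#U (μ xs)) (#D (μ xs)) (#H (μ xs)) (μStep x ∷ [])
    ≡⟨ cong₂ _++_ (entries-μ xs) (annot-single (μStep x)) ⟩
  reverse (suffixEntries xs) ++ (μStep x , #U (μ xs) , #D (μ xs) , #H (μ xs)) ∷ []
    ≡⟨ cong (λ e → reverse (suffixEntries xs) ++ e ∷ [])
            (cong₂ (λ a b → μStep x , a , b) (#U-μ xs) (cong₂ _,_ (#D-μ xs) (#H-μ xs))) ⟩
  reverse (suffixEntries xs) ++ (μStep x , #D xs , #U xs , #H xs) ∷ []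
    ≡⟨ unfold-reverse _ (suffixEntries xs) ⟨
  reverse (suffixEntries (x ∷ xs)) ∎
  where
  open ≡-Reasoning
  annot-single : ∀ {u d h} s → annot u d h (s ∷ []) ≡ (s , u , d , h) ∷ []
  annot-single U = refl
  annot-single D = refl
  annot-single H = refl

sum-entries-μ : (G : Entry → ℕ) (p : List Step) → sum (map G (suffixEntries p)) ≡ sum (map G (entries (μ p)))
sum-entries-μ G p = trans (sym (sum-map-reverse G (suffixEntries p))) (cong (sum ∘ map G) (sym (entries-μ p)))

countB-notU : ∀ xs → countB (not ∘ isU) xs ≡ #D xs + #H xs
countB-notU []       = refl
countB-notU (U ∷ xs) = countB-notU xs
countB-notU (D ∷ xs) = cong suc (countB-notU xs)
countB-notU (H ∷ xs) = trans (cong suc (countB-notU xs)) (sym (+-suc (#D xs) (#H xs)))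

sum-phiA : (F : ℕ → ℕ) (p : List Step) →
  sum (map F (phiA p)) ≡ sum (map (λ e → if isDᵉ e then F ((uBefore e + hBefore e) ∸ 1) else 0) (suffixEntries p))
sum-phiA F []       = refl
sum-phiA F (U ∷ xs) = cong₂ _+_ (cong (λ k → F (k ∸ 1)) (countB-notU xs)) (sum-phiA F xs)
sum-phiA F (D ∷ xs) = sum-phiA F xs
sum-phiA F (H ∷ xs) = sum-phiA F xs

sum-phiB : (F : ℕ → ℕ) (p : List Step) →
  sum (map F (phiB p)) ≡ sum (map (λ e → if isHᵉ e then F (uBefore e) else 0) (suffixEntries p))
sum-phiB F []       = refl
sum-phiB F (U ∷ xs) = sum-phiB F xs
sum-phiB F (D ∷ xs) = sum-phiB F xs
sum-phiB F (H ∷ xs) = cong (F (#D xs) +_) (sum-phiB F xs)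

-- The step of the entry stays weakly above the diagonal.
Above : Entry → Set
Above (U , u , dd , h) = ⊤
Above (D , u , dd , h) = suc dd ≤ u
Above (H , u , dd , h) = dd ≤ u

suffixEntries-above : ∀ k p → PrefixOK k p → k + #U p ≡ #D p → All Above (suffixEntries p)
suffixEntries-above k [] _ _ = []
suffixEntries-above k (U ∷ xs) ok e =
  ≤-trans (s≤s (m≤n+m (#U xs) k)) (≤-reflexive e′) ∷ suffixEntries-above (suc k) xs ok e′
  where e′ = trans (sym (+-suc k (#U xs))) e
suffixEntries-above k (H ∷ xs) ok e = ≤-trans (m≤n+m (#U xs) k) (≤-reflexive e) ∷ suffixEntries-above k xs ok e
suffixEntries-above (suc k) (D ∷ xs) (_ , ok) e = tt ∷ suffixEntries-above k xs ok (suc-injective e)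

entries-μ-above : ∀ p → PrefixOK 0 p → #U p ≡ #D p → All Above (entries (μ p))
entries-μ-above p ok e =
  subst (All Above) (sym (entries-μ p)) (All-resp-↭ (↭-sym (↭-reverse _)) (suffixEntries-above 0 p ok e))

_before_ : (Entry → Bool) → ℕ → Entry → Bool
(P before z) e = P e ∧ (suc (uBefore e) ≤ᵇ z)

_after_ : (Entry → Bool) → ℕ → Entry → Bool
(P after z) e = P e ∧ (z ≤ᵇ uBefore e)

before-false : (P : Entry → Bool) {z : ℕ} (e : Entry) → z ≤ uBefore e → (P before z) e ≡ false
before-false P e z≤u = trans (cong (P e ∧_) (≤ᵇ-false (λ q → <-irrefl refl (≤-trans q z≤u)))) (∧-zeroʳ (P e))

before-mono : (P : Entry → Bool) {z z′ : ℕ} → z ≤ z′ →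
              ∀ e → (P before z) e ≡ true → (P before z′) e ≡ true
before-mono P z≤z′ e q with P e
... | true  = ≤ᵇ-true (≤-trans (≤ᵇ-sound q) z≤z′)
... | false = q

countB-before-none : (P : Entry → Bool) → ∀ xs u d h {z} → z ≤ u → countB (P before z) (annot u d h xs) ≡ 0
countB-before-none P []       u d h z≤u = refl
countB-before-none P (x ∷ xs) u d h {z} z≤u = begin
  countB (P before z) (annot u d h (x ∷ xs))
    ≡⟨ cong (countB (P before z)) (annot-cons x u d h xs) ⟩
  bit ((P before z) (x , u , d , h)) + countB (P before z) (annot (u + bit (isU x)) _ _ xs)
    ≡⟨ cong₂ _+_ (cong bit (before-false P (x , u , d , h) z≤u))
                 (countB-before-none P xs _ _ _ (≤-trans z≤u (m≤m+n u _))) ⟩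
  0 ∎
  where open ≡-Reasoning

annot-uBefore-≤ : ∀ xs u d h → All (λ e → uBefore e ≤ u + #U xs) (annot u d h xs)
annot-uBefore-≤ []       u d h = []
annot-uBefore-≤ (U ∷ xs) u d h rewrite +-suc u (#U xs) =
  m≤n⇒m≤1+n (m≤m+n u _) ∷ annot-uBefore-≤ xs (suc u) d h
annot-uBefore-≤ (D ∷ xs) u d h = m≤m+n u _ ∷ annot-uBefore-≤ xs u (suc d) h
annot-uBefore-≤ (H ∷ xs) u d h = m≤m+n u _ ∷ annot-uBefore-≤ xs u d (suc h)

-- Stated with d ⊔ y so that it survives the induction, where d grows past y.
annot-#D-before-bound : ∀ xs u d h y → All Above (annot u d h xs) →
                     d + countB (isDᵉ before suc y) (annot u d h xs) ≤ d ⊔ y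
annot-#D-before-bound []       u d h y _ = ≤-trans (≤-reflexive (+-identityʳ d)) (m≤m⊔n d y)
annot-#D-before-bound (U ∷ xs) u d h y (_ ∷ a) = annot-#D-before-bound xs (suc u) d h y a
annot-#D-before-bound (H ∷ xs) u d h y (_ ∷ a) = annot-#D-before-bound xs u d (suc h) y a
annot-#D-before-bound (D ∷ xs) u d h y (d<u ∷ a) with u ≤? y
... | yes u≤y = begin
  d + (bit (suc u ≤ᵇ suc y) + rest)  ≡⟨ cong (λ b → d + (bit b + rest)) (≤ᵇ-true (s≤s u≤y)) ⟩
  d + suc rest                       ≡⟨ +-suc d rest ⟩
  suc d + rest                       ≤⟨ annot-#D-before-bound xs u (suc d) h y a ⟩
  suc d ⊔ y                          ≡⟨ m≤n⇒m⊔n≡n (≤-trans d<u u≤y) ⟩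
  y                                  ≤⟨ m≤n⊔m d y ⟩
  d ⊔ y                              ∎
  where
  open ≤-Reasoning
  rest = countB (isDᵉ before suc y) (annot u (suc d) h xs)
... | no u≰y = begin
  d + (bit (suc u ≤ᵇ suc y) + countB (isDᵉ before suc y) (annot u (suc d) h xs))
    ≡⟨ cong₂ (λ b r → d + (bit b + r)) (≤ᵇ-false (λ q → u≰y (≤-pred q)))
             (countB-before-none isDᵉ xs u (suc d) h (≰⇒> u≰y)) ⟩
  d + 0  ≡⟨ +-identityʳ d ⟩
  d      ≤⟨ m≤m⊔n d y ⟩
  d ⊔ y  ∎
  where open ≤-Reasoning

xTopU≡annot-#D-before : ∀ xs x cur y d h → cur < y → y ≤ cur + #U xs →
  xTopU x cur y (dyck xs) ≡ x + countB (isDᵉ before y) (annot cur d h xs)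
xTopU≡annot-#D-before [] x cur y d h cur<y y≤cur =
  ⊥-elim (<-irrefl refl (≤-trans cur<y (≤-trans y≤cur (≤-reflexive (+-identityʳ cur)))))
xTopU≡annot-#D-before (U ∷ xs) x cur y d h cur<y y≤ with suc cur ≟ y
... | yes refl = trans (if-true (≡ᵇ-true {suc cur} refl))
  (sym (trans (cong (x +_) (countB-before-none isDᵉ xs (suc cur) d h ≤-refl)) (+-identityʳ x)))
... | no  ≢y   = trans (if-false (≡ᵇ-false ≢y))
  (xTopU≡annot-#D-before xs x (suc cur) y d h (≤∧≢⇒< cur<y ≢y) (≤-trans y≤ (≤-reflexive (+-suc cur (#U xs)))))
xTopU≡annot-#D-before (D ∷ xs) x cur y d h cur<y y≤ = begin
  xTopU (suc x) cur y (dyck xs)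
    ≡⟨ xTopU≡annot-#D-before xs (suc x) cur y (suc d) h cur<y y≤ ⟩
  suc x + countB (isDᵉ before y) (annot cur (suc d) h xs)
    ≡⟨ +-suc x _ ⟨
  x + suc (countB (isDᵉ before y) (annot cur (suc d) h xs))
    ≡⟨ cong (λ b → x + (bit b + countB (isDᵉ before y) (annot cur (suc d) h xs))) (≤ᵇ-true cur<y) ⟨
  x + countB (isDᵉ before y) (annot cur d h (D ∷ xs)) ∎
  where open ≡-Reasoning
xTopU≡annot-#D-before (H ∷ xs) x cur y d h cur<y y≤ = xTopU≡annot-#D-before xs x cur y d (suc h) cur<y y≤

hBeforeU≡annot-#H-before : ∀ xs x cur y d h → cur < y → y ≤ cur + #U xs →
  hBeforeU x cur y xs ≡ x + countB (isHᵉ before y) (annot cur d h xs)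
hBeforeU≡annot-#H-before [] x cur y d h cur<y y≤cur =
  ⊥-elim (<-irrefl refl (≤-trans cur<y (≤-trans y≤cur (≤-reflexive (+-identityʳ cur)))))
hBeforeU≡annot-#H-before (U ∷ xs) x cur y d h cur<y y≤ with suc cur ≟ y
... | yes refl = trans (if-true (≡ᵇ-true {suc cur} refl))
  (sym (trans (cong (x +_) (countB-before-none isHᵉ xs (suc cur) d h ≤-refl)) (+-identityʳ x)))
... | no  ≢y   = trans (if-false (≡ᵇ-false ≢y))
  (hBeforeU≡annot-#H-before xs x (suc cur) y d h (≤∧≢⇒< cur<y ≢y) (≤-trans y≤ (≤-reflexive (+-suc cur (#U xs)))))
hBeforeU≡annot-#H-before (H ∷ xs) x cur y d h cur<y y≤ = begin
  hBeforeU (suc x) cur y xs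
    ≡⟨ hBeforeU≡annot-#H-before xs (suc x) cur y d (suc h) cur<y y≤ ⟩
  suc x + countB (isHᵉ before y) (annot cur d (suc h) xs)
    ≡⟨ +-suc x _ ⟨
  x + suc (countB (isHᵉ before y) (annot cur d (suc h) xs))
    ≡⟨ cong (λ b → x + (bit b + countB (isHᵉ before y) (annot cur d (suc h) xs))) (≤ᵇ-true cur<y) ⟨
  x + countB (isHᵉ before y) (annot cur d h (H ∷ xs)) ∎
  where open ≡-Reasoning
hBeforeU≡annot-#H-before (D ∷ xs) x cur y d h cur<y y≤ = hBeforeU≡annot-#H-before xs x cur y (suc d) h cur<y y≤

hBeforeU-zero : ∀ x cur xs → hBeforeU x cur 0 xs ≡ 0
hBeforeU-zero x cur []       = refl
hBeforeU-zero x cur (U ∷ xs) = hBeforeU-zero x (suc cur) xs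
hBeforeU-zero x cur (D ∷ xs) = hBeforeU-zero x cur xs
hBeforeU-zero x cur (H ∷ xs) = hBeforeU-zero (suc x) cur xs

-- T is the number of H steps before the y-th U step.
FlatsSplitAt : ℕ → ℕ → Entry → Set
FlatsSplitAt y T e = (uBefore e < y → hBefore e + bit (isHᵉ e) ≤ T) × (y ≤ uBefore e → T ≤ hBefore e)

annot-flatsSplitAt : ∀ y xs u d h k T → k + countB (isHᵉ before y) (annot u d h xs) ≡ T →
                     (u < y → k ≡ h) → k ≤ h → All (FlatsSplitAt y T) (annot u d h xs)
annot-flatsSplitAt y []       u d h k T eq k≡h k≤h = []
annot-flatsSplitAt y (x ∷ xs) u d h k T eq k≡h k≤h =
  subst (All (FlatsSplitAt y T)) (sym (annot-cons x u d h xs)) (split (u <? y))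
  where
  u₁ = u + bit (isU x)
  d₁ = d + bit (isD x)
  h₁ = h + bit (isH x)
  rest = countB (isHᵉ before y) (annot u₁ d₁ h₁ xs)
  eq′ : k + (bit (isH x ∧ (suc u ≤ᵇ y)) + rest) ≡ T
  eq′ = trans (cong (λ l → k + countB (isHᵉ before y) l) (sym (annot-cons x u d h xs))) eq
  split : Dec (u < y) → All (FlatsSplitAt y T) ((x , u , d , h) ∷ annot u₁ d₁ h₁ xs)
  split (yes u<y) =
      ( (λ _ → ≤-trans (≤-reflexive (cong₂ _+_ (sym (k≡h u<y)) (cong bit (sym counted))))
                       (≤-trans (m≤m+n _ rest) (≤-reflexive (trans (+-assoc k _ rest) eq′))))
      , (λ y≤u → ⊥-elim (<-irrefl refl (≤-trans u<y y≤u))))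
    ∷ annot-flatsSplitAt y xs u₁ d₁ h₁ (k + bit (isH x)) T
        (trans (+-assoc k _ rest) (trans (cong (λ b → k + (bit b + rest)) (sym counted)) eq′))
        (λ _ → cong (_+ bit (isH x)) (k≡h u<y)) (≤-reflexive (cong (_+ bit (isH x)) (k≡h u<y)))
    where
    counted : isH x ∧ (suc u ≤ᵇ y) ≡ isH x
    counted = trans (cong (isH x ∧_) (≤ᵇ-true u<y)) (∧-identityʳ (isH x))
  split (no u≮y) =
      ((λ u<y → ⊥-elim (u≮y u<y)) , (λ _ → subst (_≤ h) k≡T k≤h))
    ∷ annot-flatsSplitAt y xs u₁ d₁ h₁ k T (trans (cong (k +_) (sym (cong (λ b → bit b + rest) skipped))) eq′)
        (λ u₁<y → ⊥-elim (u≮y (≤-trans (s≤s (m≤m+n u _)) u₁<y))) (≤-trans k≤h (m≤m+n h _))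
    where
    y≤u = ≮⇒≥ u≮y
    skipped : isH x ∧ (suc u ≤ᵇ y) ≡ false
    skipped = before-false (isH ∘ stepOf) (x , u , d , h) y≤u
    k≡T : k ≡ T
    k≡T = trans (sym (+-identityʳ k)) (trans (cong (k +_) (sym (cong₂ (λ b q → bit b + q) skipped
            (countB-before-none isHᵉ xs u₁ d₁ h₁ (≤-trans y≤u (m≤m+n u _)))))) eq′)

countB-after+before : (P : Entry → Bool) (z : ℕ) (xs : List Entry) →
                      countB (P after z) xs + countB (P before z) xs ≡ countB P xs
countB-after+before P z xs = begin
  countB (P after z) xs + countB (P before z) xs
    ≡⟨ +-comm (countB (P after z) xs) _ ⟩
  countB (P before z) xs + countB (P after z) xs
    ≡⟨ cong (countB (P before z) xs +_) (countB-cong (λ e → cong (P e ∧_) (sym (not-<ᵇ (uBefore e) z))) xs) ⟩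
  countB (P before z) xs + countB (λ e → P e ∧ not (suc (uBefore e) ≤ᵇ z)) xs
    ≡⟨ countB-∧-split P (λ e → suc (uBefore e) ≤ᵇ z) xs ⟩
  countB P xs ∎
  where open ≡-Reasoning

#D-before #H-before : List Step → ℕ → ℕ
#D-before w z = countB (isDᵉ before z) (entries w)
#H-before w z = countB (isHᵉ before z) (entries w)

module _ (w : List Step) where

  #D-before-suc≤ : All Above (entries w) → ∀ y → #D-before w (suc y) ≤ y
  #D-before-suc≤ above y = annot-#D-before-bound w 0 0 0 y above

  countB-before-top : (q : Step → Bool) → countB ((q ∘ stepOf) before suc (#U w)) (entries w) ≡ countB q w
  countB-before-top q = begin
    countB ((q ∘ stepOf) before suc (#U w)) (entries w)
      ≡⟨ countB-cong-local (All.map (λ {e} u≤ → cong (q (stepOf e) ∧_) (≤ᵇ-true (s≤s u≤)))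
                                    (annot-uBefore-≤ w 0 0 0)) ⟩
    countB (λ e → q (stepOf e) ∧ true) (entries w)
      ≡⟨ countB-cong (λ e → ∧-identityʳ (q (stepOf e))) (entries w) ⟩
    countB (q ∘ stepOf) (entries w)
      ≡⟨ countB-annot-stepOf q 0 0 0 w ⟩
    countB q w ∎
    where open ≡-Reasoning

  #D-before-zero : #D-before w 0 ≡ 0
  #D-before-zero = countB-before-none isDᵉ w 0 0 0 z≤n

  #H-before-zero : #H-before w 0 ≡ 0
  #H-before-zero = countB-before-none isHᵉ w 0 0 0 z≤n

  #H-before-mono : ∀ {z z′} → z ≤ z′ → #H-before w z ≤ #H-before w z′
  #H-before-mono z≤z′ = countB-mono (before-mono isHᵉ z≤z′) (entries w)

  entries-flatsSplitAt : ∀ y → All (FlatsSplitAt y (#H-before w y)) (entries w)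
  entries-flatsSplitAt y = annot-flatsSplitAt y w 0 0 0 0 (#H-before w y) refl (λ _ → refl) z≤n

  -- Shifting the threshold z by the number of H steps before the z-th U step turns a
  -- condition on the height u + h of an entry into the condition z ≤ u.
  downs-above-height : ∀ z → countB (λ e → isDᵉ e ∧ (z + #H-before w z ≤ᵇ uBefore e + hBefore e)) (entries w)
                             ≡ countB (isDᵉ after z) (entries w)
  downs-above-height z = countB-cong-local (All.map (λ {e} s → cong (isDᵉ e ∧_) (pointwise e s)) (entries-flatsSplitAt z))
    where
    pointwise : ∀ e → FlatsSplitAt z (#H-before w z) e →
                (z + #H-before w z ≤ᵇ uBefore e + hBefore e) ≡ (z ≤ᵇ uBefore e)
    pointwise e (below , above) with uBefore e <? z
    ... | yes u<z =
      trans (≤ᵇ-false (λ le → <-irrefl refl (≤-trans (+-mono-<-≤ u<z (≤-trans (m≤m+n _ _) (below u<z))) le)))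
            (sym (≤ᵇ-false (<⇒≱ u<z)))
    ... | no  u≮z =
      trans (≤ᵇ-true (+-mono-≤ (≮⇒≥ u≮z) (above (≮⇒≥ u≮z)))) (sym (≤ᵇ-true (≮⇒≥ u≮z)))

  flats-below-height : ∀ y → countB (λ e → isHᵉ e ∧ (suc (uBefore e + hBefore e) ≤ᵇ y + #H-before w y)) (entries w)
                             ≡ #H-before w y
  flats-below-height y = countB-cong-local (All.map (λ {e} s → pointwise e s) (entries-flatsSplitAt y))
    where
    pointwise : ∀ e → FlatsSplitAt y (#H-before w y) e →
                isHᵉ e ∧ (suc (uBefore e + hBefore e) ≤ᵇ y + #H-before w y) ≡ (isHᵉ before y) e
    pointwise (U , u , dd , h) _ = refl
    pointwise (D , u , dd , h) _ = refl
    pointwise (H , u , dd , h) (below , above) with u <? y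
    ... | yes u<y = trans (≤ᵇ-true (+-mono-≤ u<y (≤-trans (m≤m+n h 1) (below u<y)))) (sym (≤ᵇ-true u<y))
    ... | no  u≮y =
      trans (≤ᵇ-false (λ le → <-irrefl refl (≤-trans (s≤s (+-mono-≤ (≮⇒≥ u≮y) (above (≮⇒≥ u≮y)))) le)))
            (sym (≤ᵇ-false u≮y))

  xTopU≡#D-before : ∀ y → 1 ≤ y → y ≤ #U w → xTopU 0 0 y (dyck w) ≡ #D-before w y
  xTopU≡#D-before y 1≤y y≤ = xTopU≡annot-#D-before w 0 0 y 0 0 1≤y y≤

  hBeforeU≡#H-before : ∀ y → y ≤ #U w → hBeforeU 0 0 y w ≡ #H-before w y
  hBeforeU≡#H-before zero    _  = trans (hBeforeU-zero 0 0 w) (sym #H-before-zero)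
  hBeforeU≡#H-before (suc y) y≤ = hBeforeU≡annot-#H-before w 0 0 (suc y) 0 0 (s≤s z≤n) y≤

module Toppling {n d : ℕ} (c : Cfg n d) where

  VSet : Set
  VSet = NS n d → Bool

  #nbrs : VSet → NS n d → ℕ
  #nbrs S v = countB (λ u → S u ∧ adj u v) (allNS n d)

  base : VSet → NS n d → ℕ
  base S v = suc (val c v) + #nbrs S v

  -- The configuration after toppling the sink and every vertex of S once. Under Legal S (each
  -- vertex of S is unstable once the sink and its neighbours in S have toppled) the
  -- subtraction never truncates.
  afterToppling : VSet → Cfg n d
  afterToppling S = tabulate (grains ∘ cl) , tabulate (grains ∘ ind)
    where
    grains : NS n d → ℕ
    grains v = base S v ∸ (if S v then deg v else 0)

  Legal : VSet → Set
  Legal S = ∀ v → S v ≡ true → deg v ≤ base S v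

  val-afterToppling : ∀ S v → val (afterToppling S) v ≡ base S v ∸ (if S v then deg v else 0)
  val-afterToppling S (cl i)  = lookup∘tabulate _ i
  val-afterToppling S (ind j) = lookup∘tabulate _ j

  val-afterToppling-false : ∀ S v → S v ≡ false → val (afterToppling S) v ≡ base S v
  val-afterToppling-false S v Sv = trans (val-afterToppling S v) (cong (λ b → base S v ∸ (if b then deg v else 0)) Sv)

  #nbrs-cong : ∀ {S S′} → (∀ v → S v ≡ S′ v) → ∀ v → #nbrs S v ≡ #nbrs S′ v
  #nbrs-cong e v = countB-cong (λ u → cong (_∧ adj u v) (e u)) (allNS n d)

  afterToppling-cong : ∀ {S S′} → (∀ v → S v ≡ S′ v) → afterToppling S ≡ afterToppling S′
  afterToppling-cong {S} {S′} e = cong₂ _,_ (tabulate-cong (pointwise ∘ cl)) (tabulate-cong (pointwise ∘ ind))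
    where
    pointwise : ∀ v → base S v ∸ (if S v then deg v else 0) ≡ base S′ v ∸ (if S′ v then deg v else 0)
    pointwise v = cong₂ (λ k b → (suc (val c v) + k) ∸ (if b then deg v else 0)) (#nbrs-cong e v) (e v)

  Legal-cong : ∀ {S S′} → (∀ v → S v ≡ S′ v) → Legal S → Legal S′
  Legal-cong {S} {S′} e legal v S′v =
    subst (λ k → deg v ≤ suc (val c v) + k) (#nbrs-cong e v) (legal v (trans (e v) S′v))

  afterToppling-∅ : afterToppling (λ _ → false) ≡ toppleSink c
  afterToppling-∅ = cong₂ _,_ (shift (proj₁ c)) (shift (proj₂ c))
    where
    shift : ∀ {m} (a : Vec ℕ m) →
            tabulate (λ i → suc (lookup a i) + countB (λ _ → false) (allNS n d) ∸ 0) ≡ V.map suc a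
    shift a = begin
      tabulate (λ i → suc (lookup a i) + countB (λ _ → false) (allNS n d))
        ≡⟨ tabulate-cong (λ i → trans (cong (suc (lookup a i) +_) (countB-false (allNS n d))) (+-identityʳ _)) ⟩
      tabulate (λ i → suc (lookup a i))
        ≡⟨ tabulate-cong (λ i → lookup-map i suc a) ⟨
      tabulate (lookup (V.map suc a))
        ≡⟨ tabulate∘lookup (V.map suc a) ⟩
      V.map suc a ∎
      where open ≡-Reasoning

  Disjoint : VSet → VSet → Set
  Disjoint S X = ∀ v → X v ≡ true → S v ≡ false

  ∧-disjoint : ∀ {S X} → Disjoint S X → ∀ v → S v ∧ X v ≡ false
  ∧-disjoint {S} {X} disj v with S v in es | X v in ex
  ... | true  | true  = case trans (sym (disj v ex)) es of λ ()
  ... | true  | false = refl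
  ... | false | _     = refl

  #nbrs-∨ : ∀ S X → Disjoint S X → ∀ v → #nbrs (λ u → S u ∨ X u) v ≡ #nbrs S v + #nbrs X v
  #nbrs-∨ S X disj v = trans (countB-cong (λ u → ∧-distribʳ-∨ (adj u v) (S u) (X u)) (allNS n d))
    (countB-∨ (λ u → S u ∧ adj u v) (λ u → X u ∧ adj u v) disj′ (allNS n d))
    where
    disj′ : ∀ u → (S u ∧ adj u v) ∧ (X u ∧ adj u v) ≡ false
    disj′ u with S u in es | X u in ex
    ... | true  | true  = case trans (sym (disj u ex)) es of λ ()
    ... | true  | false = ∧-zeroʳ (adj u v)
    ... | false | _     = refl

  countB-∨ᵛ : ∀ S X → Disjoint S X →
              countB (λ v → S v ∨ X v) (allNS n d) ≡ countB S (allNS n d) + countB X (allNS n d)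
  countB-∨ᵛ S X disj = countB-∨ S X (∧-disjoint disj) (allNS n d)

  base-∨ : ∀ S X → Disjoint S X → ∀ v → base (λ u → S u ∨ X u) v ≡ base S v + #nbrs X v
  base-∨ S X disj v = trans (cong (suc (val c v) +_) (#nbrs-∨ S X disj v)) (sym (+-assoc (suc (val c v)) _ _))

  toppleSet-afterToppling : ∀ S X → Legal S → Disjoint S X →
    (∀ v → X v ≡ true → deg v ≤ val (afterToppling S) v) →
    (toppleSet X (afterToppling S) ≡ afterToppling (λ v → S v ∨ X v)) × Legal (λ v → S v ∨ X v)
  toppleSet-afterToppling S X legal disj unstable =
    cong₂ _,_ (tabulate-cong (pointwise ∘ cl)) (tabulate-cong (pointwise ∘ ind)) , legal′
    where
    S∨X = λ v → S v ∨ X v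
    shifted : ∀ v t → t ≤ base S v → (base S v ∸ t) + #nbrs X v ≡ base S∨X v ∸ t
    shifted v t t≤ = trans (sym (+-∸-comm (#nbrs X v) t≤)) (cong (_∸ t) (sym (base-∨ S X disj v)))
    unstable′ : ∀ v → X v ≡ true → S v ≡ false → deg v ≤ base S v
    unstable′ v Xv Sv = subst (deg v ≤_) (val-afterToppling-false S v Sv) (unstable v Xv)
    pointwise : ∀ v → val (afterToppling S) v ∸ (if X v then deg v else 0) + #nbrs X v
                      ≡ base S∨X v ∸ (if S v ∨ X v then deg v else 0)
    pointwise v rewrite val-afterToppling S v with S v in es | X v in ex
    ... | true  | true  = case trans (sym (disj v ex)) es of λ ()
    ... | true  | false = shifted v (deg v) (legal v es)
    ... | false | true  = shifted v (deg v) (unstable′ v ex es)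
    ... | false | false = shifted v 0 z≤n
    grows : ∀ v → base S v ≤ base S∨X v
    grows v = ≤-trans (m≤m+n (base S v) _) (≤-reflexive (sym (base-∨ S X disj v)))
    legal′ : Legal S∨X
    legal′ v _ with S v in es | X v in ex
    ... | true  | _     = ≤-trans (legal v es) (grows v)
    ... | false | true  = ≤-trans (unstable′ v ex es) (grows v)

  #nbrs-ind : ∀ S j → #nbrs S (ind j) ≡ countFin (λ i → S (cl i))
  #nbrs-ind S j = begin
    #nbrs S (ind j)
      ≡⟨ countB-allNS (λ u → S u ∧ adj u (ind j)) ⟩
    countFin (λ i → S (cl i) ∧ true) + countFin (λ j′ → S (ind j′) ∧ false)
      ≡⟨ cong₂ _+_ (countFin-cong (λ i → ∧-identityʳ (S (cl i))))
                   (countFin-false _ (λ j′ → ∧-zeroʳ (S (ind j′)))) ⟩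
    countFin (λ i → S (cl i)) + 0
      ≡⟨ +-identityʳ _ ⟩
    countFin (λ i → S (cl i)) ∎
    where open ≡-Reasoning

  #nbrs-cl : ∀ S i → S (cl i) ≡ false → #nbrs S (cl i) ≡ countB S (allNS n d)
  #nbrs-cl S i Si = begin
    #nbrs S (cl i)
      ≡⟨ countB-allNS (λ u → S u ∧ adj u (cl i)) ⟩
    countFin (λ j → S (cl j) ∧ not (does (j Fin.≟ i))) + countFin (λ j → S (ind j) ∧ true)
      ≡⟨ cong₂ _+_ (countFin-cong clique) (countFin-cong (λ j → ∧-identityʳ (S (ind j)))) ⟩
    countFin (λ j → S (cl j)) + countFin (λ j → S (ind j))
      ≡⟨ countB-allNS S ⟨
    countB S (allNS n d) ∎
    where
    open ≡-Reasoning
    clique : ∀ j → S (cl j) ∧ not (does (j Fin.≟ i)) ≡ S (cl j)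
    clique j with j Fin.≟ i
    ... | yes refl = trans (∧-zeroʳ (S (cl j))) (sym Si)
    ... | no  _    = ∧-identityʳ (S (cl j))

  suc-#nbrs-all : ∀ v → suc (#nbrs (λ _ → true) v) ≡ deg v
  suc-#nbrs-all (cl i) = begin
    suc (#nbrs (λ _ → true) (cl i))
      ≡⟨ cong suc (countB-allNS (λ u → adj u (cl i))) ⟩
    suc (countFin (λ j → not (does (j Fin.≟ i))) + countFin {d} (λ _ → true))
      ≡⟨ cong (λ k → suc (countFin (λ j → not (does (j Fin.≟ i))) + k)) (countFin-true {d} _ (λ _ → refl)) ⟩
    suc (countFin (λ j → not (does (j Fin.≟ i))) + d)
      ≡⟨ cong (_+ d) (countFin-≢ i) ⟩
    n + d ∎
    where open ≡-Reasoning
  suc-#nbrs-all (ind j) = begin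
    suc (#nbrs (λ _ → true) (ind j))
      ≡⟨ cong suc (#nbrs-ind (λ _ → true) j) ⟩
    suc (countFin {n} (λ _ → true))
      ≡⟨ cong suc (countFin-true {n} _ (λ _ → refl)) ⟩
    suc n
      ≡⟨ +-comm 1 n ⟩
    n + 1 ∎
    where open ≡-Reasoning

  #nbrs<deg : ∀ S v → #nbrs S v < deg v
  #nbrs<deg S v = ≤-trans (s≤s (countB-mono (λ u → ∧-true-right (S u)) (allNS n d))) (≤-reflexive (suc-#nbrs-all v))

  unstableIn : VSet → VSet → VSet
  unstableIn P S v = P v ∧ unstableB (afterToppling S) v

  module _ (stable : Stable c) where

    toppled-stable : ∀ S v → S v ≡ true → val (afterToppling S) v < deg v
    toppled-stable S v Sv = begin-strict
      val (afterToppling S) v  ≡⟨ val-afterToppling S v ⟩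
      base S v ∸ (if S v then deg v else 0)  ≡⟨ cong (λ b → base S v ∸ (if b then deg v else 0)) Sv ⟩
      base S v ∸ deg v  ≤⟨ m≤n+o⇒m∸n≤o (base S v) (deg v) base≤ ⟩
      val c v  <⟨ stable v ⟩
      deg v  ∎
      where
      open ≤-Reasoning
      base≤ : base S v ≤ deg v + val c v
      base≤ = ≤-trans (≤-reflexive (sym (+-suc (val c v) (#nbrs S v))))
                (≤-trans (+-monoʳ-≤ (val c v) (#nbrs<deg S v)) (≤-reflexive (+-comm (val c v) (deg v))))

    unstable-untoppled : ∀ P S → Disjoint S (unstableIn P S)
    unstable-untoppled P S v q with S v in es
    ... | false = refl
    ... | true  = ⊥-elim (<⇒≱ (toppled-stable S v es) (≤ᵇ-sound (∧-true-right (P v) q)))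

    -- One half-round of ITC toppling: the unstable vertices of class P topple together.
    phase : ∀ P S S′ → Legal S → (∀ v → (S v ∨ unstableIn P S v) ≡ S′ v) →
      (toppleSet (unstableIn P S) (afterToppling S) ≡ afterToppling S′) × Legal S′
      × (countB (unstableIn P S) (allNS n d) + countB S (allNS n d) ≡ countB S′ (allNS n d))
    phase P S S′ legal e =
        trans (proj₁ step) (afterToppling-cong e)
      , Legal-cong e (proj₂ step)
      , (begin
          countB (unstableIn P S) (allNS n d) + countB S (allNS n d)
            ≡⟨ +-comm _ (countB S (allNS n d)) ⟩
          countB S (allNS n d) + countB (unstableIn P S) (allNS n d)
            ≡⟨ countB-∨ᵛ S (unstableIn P S) (unstable-untoppled P S) ⟨
          countB (λ v → S v ∨ unstableIn P S v) (allNS n d)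
            ≡⟨ countB-cong e (allNS n d) ⟩
          countB S′ (allNS n d) ∎)
      where
      open ≡-Reasoning
      step = toppleSet-afterToppling S (unstableIn P S) legal (unstable-untoppled P S)
               (λ v q → ≤ᵇ-sound (∧-true-right (P v) q))

threshold : ∀ {a x m} b → a + x ≡ m → (m ≤ b + a → x ≤ b) × (x ≤ b → m ≤ b + a)
threshold {a} {x} {m} b a+x≡m =
    (λ m≤ → +-cancelˡ-≤ a x b (≤-trans (≤-reflexive a+x≡m) (≤-trans m≤ (≤-reflexive (+-comm b a)))))
  , (λ x≤b → ≤-trans (≤-reflexive (sym a+x≡m)) (≤-trans (+-monoʳ-≤ a x≤b) (≤-reflexive (+-comm a b))))

<-swap : ∀ {a b a′ b′} → a + b ≡ a′ + b′ → b′ < b → a < a′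
<-swap {a} {b} {a′} {b′} e b′<b with a <? a′
... | yes a<a′ = a<a′
... | no  a≮a′ = ⊥-elim (<-irrefl (sym e) (+-mono-≤-< (≮⇒≥ a≮a′) b′<b))

weight-from-counts : ∀ q p s s₁ s₂ r r₂ N →
  q + s ≡ s₁ → p + s₁ ≡ s₂ → s + r ≡ N → s₂ + r₂ ≡ N → (q + p) + r₂ ≡ r
weight-from-counts q p s s₁ s₂ r r₂ N e₁ e₂ e₃ e₄ = +-cancelˡ-≡ s _ _ (begin
  s + ((q + p) + r₂)  ≡⟨ rearrange q p s r₂ ⟩
  (p + (q + s)) + r₂  ≡⟨ cong (λ t → (p + t) + r₂) e₁ ⟩
  (p + s₁) + r₂       ≡⟨ cong (_+ r₂) e₂ ⟩
  s₂ + r₂             ≡⟨ trans e₄ (sym e₃) ⟩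
  s + r               ∎)
  where
  open ≡-Reasoning
  rearrange : ∀ q p s r₂ → s + ((q + p) + r₂) ≡ (p + (q + s)) + r₂
  rearrange = solve-∀

-- downs z and flats z play the roles of the numbers of D steps and of H steps before the z-th
-- U step of the mirrored Schröder word; the counting laws tie them to the configuration.
record ThresholdProfile {n d : ℕ} (c : Cfg n d) : Set where
  field
    downs flats  : ℕ → ℕ
    clique-count : ∀ z → countFin (λ i → z + flats z ≤ᵇ suc (lookup (proj₁ c) i)) + downs z ≡ n
    indep-count  : ∀ z → countFin (λ j → z ≤ᵇ lookup (proj₂ c) j) + flats z ≡ d
    downs-suc≤   : ∀ y → downs (suc y) ≤ y
    downs-zero   : downs 0 ≡ 0
    flats-zero   : flats 0 ≡ 0
    flats-mono   : ∀ {z z′} → z ≤ z′ → flats z ≤ flats z′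
    downs-top    : downs (suc n) ≡ n
    flats-top    : flats (suc n) ≡ d

module ITCOrbit {n d : ℕ} (c : Cfg n d) (stable : Stable c) (T : ThresholdProfile c) where

  open Toppling c
  open ThresholdProfile T

  toppled : ℕ → VSet
  toppled z (cl i)  = z + flats z ≤ᵇ suc (lookup (proj₁ c) i)
  toppled z (ind j) = z ≤ᵇ lookup (proj₂ c) j

  #toppled : ℕ → ℕ
  #toppled z = countB (toppled z) (allNS n d)

  R : ℕ → ℕ
  R z = downs z + flats z

  #toppled+R : ∀ z → #toppled z + R z ≡ n + d
  #toppled+R z = trans (cong (_+ R z) (countB-allNS (toppled z)))
    (trans (interchange (countFin (toppled z ∘ cl)) _ (downs z) (flats z)) (cong₂ _+_ (clique-count z) (indep-count z)))

  downs≤ : ∀ z → downs z ≤ z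
  downs≤ zero    = ≤-reflexive downs-zero
  downs≤ (suc y) = m≤n⇒m≤1+n (downs-suc≤ y)

  R≡0⇒downs≡0 : ∀ {z} → R z ≡ 0 → downs z ≡ 0
  R≡0⇒downs≡0 {z} = m+n≡0⇒m≡0 (downs z)

  R-zero : R 0 ≡ 0
  R-zero = cong₂ _+_ downs-zero flats-zero

  val-ind : ∀ S j → S (ind j) ≡ false → val (afterToppling S) (ind j) ≡ suc (lookup (proj₂ c) j) + countFin (S ∘ cl)
  val-ind S j Sj = trans (val-afterToppling-false S (ind j) Sj) (cong (suc (lookup (proj₂ c) j) +_) (#nbrs-ind S j))

  val-cl : ∀ S i → S (cl i) ≡ false → val (afterToppling S) (cl i) ≡ suc (lookup (proj₁ c) i) + countB S (allNS n d)
  val-cl S i Si = trans (val-afterToppling-false S (cl i) Si) (cong (suc (lookup (proj₁ c) i) +_) (#nbrs-cl S i Si))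

  indep-threshold : ∀ z j → toppled z (ind j) ≡ false →
    (n + 1 ≤ val (afterToppling (toppled z)) (ind j) → downs z ≤ lookup (proj₂ c) j)
    × (downs z ≤ lookup (proj₂ c) j → n + 1 ≤ val (afterToppling (toppled z)) (ind j))
  indep-threshold z j Tj rewrite val-ind (toppled z) j Tj =
      (λ le → ≤-pred (proj₁ shift le)) , (λ le → proj₂ shift (s≤s le))
    where
    shift = threshold (suc (lookup (proj₂ c) j))
              (trans (+-suc _ (downs z)) (trans (cong suc (clique-count z)) (+-comm 1 n)))

  halfway : ℕ → VSet
  halfway z (cl i)  = toppled z (cl i)
  halfway z (ind j) = toppled (downs z) (ind j)

  independents-topple : ∀ z v → (toppled z v ∨ unstableIn isInd (toppled z) v) ≡ halfway z v
  independents-topple z (cl i)  = ∨-identityʳ _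
  independents-topple z (ind j) with toppled z (ind j) in Tj
  ... | true  = sym (≤ᵇ-true (≤-trans (downs≤ z) (≤ᵇ-sound Tj)))
  ... | false = bool-ext (λ q → ≤ᵇ-true (proj₁ (indep-threshold z j Tj) (≤ᵇ-sound q)))
                         (λ q → ≤ᵇ-true (proj₂ (indep-threshold z j Tj) (≤ᵇ-sound q)))

  cliques-topple : ∀ z v → (halfway z v ∨ unstableIn isCl (halfway z) v) ≡ toppled (downs z) v
  cliques-topple z (ind j) = ∨-identityʳ _
  cliques-topple z (cl i) with halfway z (cl i) in Mi
  ... | true  = sym (≤ᵇ-true (≤-trans (+-mono-≤ (downs≤ z) (flats-mono (downs≤ z))) (≤ᵇ-sound Mi)))
  ... | false = bool-ext (λ q → ≤ᵇ-true (proj₁ shift (unstable⇒ (≤ᵇ-sound q))))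
                         (λ q → ≤ᵇ-true (⇒unstable (proj₂ shift (≤ᵇ-sound q))))
    where
    ai = lookup (proj₁ c) i
    #halfway = countB (halfway z) (allNS n d)
    shift = threshold (suc ai) (begin
      #halfway + (downs z + flats (downs z))
        ≡⟨ cong (_+ (downs z + flats (downs z))) (countB-allNS (halfway z)) ⟩
      countFin (toppled z ∘ cl) + countFin (toppled (downs z) ∘ ind) + (downs z + flats (downs z))
        ≡⟨ interchange (countFin (toppled z ∘ cl)) _ (downs z) _ ⟩
      (countFin (toppled z ∘ cl) + downs z) + (countFin (toppled (downs z) ∘ ind) + flats (downs z))
        ≡⟨ cong₂ _+_ (clique-count z) (indep-count (downs z)) ⟩
      n + d ∎)
      where open ≡-Reasoning
    unstable⇒ : n + d ≤ val (afterToppling (halfway z)) (cl i) → n + d ≤ suc ai + #halfway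
    unstable⇒ = subst (n + d ≤_) (val-cl (halfway z) i Mi)
    ⇒unstable : n + d ≤ suc ai + #halfway → n + d ≤ val (afterToppling (halfway z)) (cl i)
    ⇒unstable = subst (n + d ≤_) (sym (val-cl (halfway z) i Mi))

  round : ∀ z → Legal (toppled z) →
    (proj₁ (itcRound (afterToppling (toppled z))) ≡ afterToppling (toppled (downs z)))
    × Legal (toppled (downs z))
    × (proj₂ (itcRound (afterToppling (toppled z))) + R (downs z) ≡ R z)
  round z legal = cliquePhase _ (proj₁ first)
    where
    first = phase stable isInd (toppled z) (halfway z) legal (independents-topple z)
    q = countB (unstableIn isInd (toppled z)) (allNS n d)
    cliquePhase : ∀ c₁ → c₁ ≡ afterToppling (halfway z) →
      let P = λ v → isCl v ∧ unstableB c₁ v in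
      (toppleSet P c₁ ≡ afterToppling (toppled (downs z))) × Legal (toppled (downs z))
      × ((q + countB P (allNS n d)) + R (downs z) ≡ R z)
    cliquePhase _ refl =
        proj₁ second , proj₁ (proj₂ second)
      , weight-from-counts q _ (#toppled z) _ (#toppled (downs z)) (R z) (R (downs z)) (n + d)
          (proj₂ (proj₂ first)) (proj₂ (proj₂ second)) (#toppled+R z) (#toppled+R (downs z))
      where second = phase stable isCl (halfway z) (toppled (downs z)) (proj₁ (proj₂ first)) (cliques-topple z)

  orbit : ℕ → ℕ
  orbit = fold (suc n) downs

  nothing-toppled-at-top : ∀ v → toppled (suc n) v ≡ false
  nothing-toppled-at-top (cl i)  = countFin≡0⇒false (toppled (suc n) ∘ cl)
    (+-cancelʳ-≡ n _ 0 (trans (cong (countFin (toppled (suc n) ∘ cl) +_) (sym downs-top)) (clique-count (suc n)))) i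
  nothing-toppled-at-top (ind j) = countFin≡0⇒false (toppled (suc n) ∘ ind)
    (+-cancelʳ-≡ d _ 0 (trans (cong (countFin (toppled (suc n) ∘ ind) +_) (sym flats-top)) (indep-count (suc n)))) j

  itcConf-orbit : ∀ r → (itcConf c r ≡ afterToppling (toppled (orbit r))) × Legal (toppled (orbit r))
  itcConf-orbit zero =
      trans (sym afterToppling-∅) (afterToppling-cong (λ v → sym (nothing-toppled-at-top v)))
    , Legal-cong (λ v → sym (nothing-toppled-at-top v)) (λ v ())
  itcConf-orbit (suc r) =
      trans (cong (proj₁ ∘ itcRound) (proj₁ (itcConf-orbit r))) (proj₁ (round (orbit r) (proj₂ (itcConf-orbit r))))
    , proj₁ (proj₂ (round (orbit r) (proj₂ (itcConf-orbit r))))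

  round-size : ∀ r → proj₂ (itcRound (itcConf c r)) + R (orbit (suc r)) ≡ R (orbit r)
  round-size r = trans (cong (λ c′ → proj₂ (itcRound c′) + R (orbit (suc r))) (proj₁ (itcConf-orbit r)))
                       (proj₂ (proj₂ (round (orbit r) (proj₂ (itcConf-orbit r)))))

  -- Round r + 1 topples R (orbit r) − R (orbit (r + 1)) vertices, so Abel summation applies.
  itcWeight-orbit : ∀ K → itcWeight c K + K * R (orbit K) ≡ sumBelow K (R ∘ orbit)
  itcWeight-orbit zero    = refl
  itcWeight-orbit (suc K) = begin
    (itcWeight c K + suc K * δ) + suc K * R (orbit (suc K))
      ≡⟨ +-assoc (itcWeight c K) _ _ ⟩
    itcWeight c K + (suc K * δ + suc K * R (orbit (suc K)))
      ≡⟨ cong (itcWeight c K +_) (*-distribˡ-+ (suc K) δ _) ⟨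
    itcWeight c K + suc K * (δ + R (orbit (suc K)))
      ≡⟨ cong (λ t → itcWeight c K + suc K * t) (round-size K) ⟩
    itcWeight c K + (R (orbit K) + K * R (orbit K))
      ≡⟨ rearrange (itcWeight c K) (R (orbit K)) (K * R (orbit K)) ⟩
    (itcWeight c K + K * R (orbit K)) + R (orbit K)
      ≡⟨ cong (_+ R (orbit K)) (itcWeight-orbit K) ⟩
    sumBelow K (R ∘ orbit) + R (orbit K)
      ≡⟨ sumBelow-snoc K (R ∘ orbit) ⟨
    sumBelow (suc K) (R ∘ orbit) ∎
    where
    open ≡-Reasoning
    δ = proj₂ (itcRound (itcConf c K))
    rearrange : ∀ a b e → a + (b + e) ≡ (a + e) + b
    rearrange = solve-∀

  R≡0⇒stable : ∀ z → R z ≡ 0 → Stable (afterToppling (toppled z))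
  R≡0⇒stable z R≡0 v = toppled-stable stable (toppled z) v (all-toppled v)
    where
    all-toppled : ∀ v → toppled z v ≡ true
    all-toppled (cl i)  = countFin≡n⇒true (toppled z ∘ cl)
      (trans (sym (+-identityʳ _))
        (trans (cong (countFin (toppled z ∘ cl) +_) (sym (R≡0⇒downs≡0 R≡0))) (clique-count z))) i
    all-toppled (ind j) = countFin≡n⇒true (toppled z ∘ ind)
      (trans (sym (+-identityʳ _))
        (trans (cong (countFin (toppled z ∘ ind) +_) (sym (m+n≡0⇒n≡0 (downs z) R≡0))) (indep-count z))) j

  -- In a stable configuration no further vertex has reached its threshold, which forces
  -- the profile to be constant from z on: flats (downs z) = flats z, and then downs z = 0.
  stable⇒R≡0 : ∀ z → Stable (afterToppling (toppled z)) → R z ≡ 0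
  stable⇒R≡0 z st = trans (cong₂ _+_ downs≡0 (sym flats-fixed)) (trans (cong flats downs≡0) flats-zero)
    where
    S = toppled z
    flats-fixed : flats (downs z) ≡ flats z
    flats-fixed = ≤-antisym (flats-mono (downs≤ z)) (≮⇒≥ no-new-independent)
      where
      no-new-independent : ¬ flats (downs z) < flats z
      no-new-independent lt with countFin-<⇒witness (toppled (downs z) ∘ ind) (S ∘ ind)
                                   (<-swap (trans (indep-count z) (sym (indep-count (downs z)))) lt)
      ... | j , new , old = <⇒≱ (st (ind j)) (proj₂ (indep-threshold z j old) (≤ᵇ-sound new))
    no-new-clique : ∀ y → downs z ≡ suc y → ⊥
    no-new-clique y eq with countFin-<⇒witness (toppled (downs z) ∘ cl) (S ∘ cl)
                              (<-swap (trans (clique-count z) (sym (clique-count (downs z))))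
                                      (subst (λ t → downs t < t) (sym eq) (s≤s (downs-suc≤ y))))
    ... | i , new , old = <⇒≱ (st (cl i)) (subst (n + d ≤_) (sym (val-cl S i old)) (proj₂ shift (≤ᵇ-sound new)))
      where
      shift = threshold (suc (lookup (proj₁ c) i))
                (trans (cong (λ h → #toppled z + (downs z + h)) flats-fixed) (#toppled+R z))
    downs≡0 : downs z ≡ 0
    downs≡0 with downs z in eq
    ... | zero  = refl
    ... | suc y = ⊥-elim (no-new-clique y eq)

  R-orbit-vanishes : ∀ r → suc n ≤ r → R (orbit r) ≡ 0
  R-orbit-vanishes r le = trans (cong R orbit≡0) R-zero
    where
    orbit≡0 : orbit r ≡ 0
    orbit≡0 = n≤0⇒n≡0 (≤-trans (fold-≤-∸ downs downs-suc≤ downs-zero (suc n) r)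
                               (≤-reflexive (m≤n⇒m∸n≡0 le)))

  R-orbit-stays-0 : ∀ K → R (orbit K) ≡ 0 → ∀ r → K ≤ r → R (orbit r) ≡ 0
  R-orbit-stays-0 K R≡0 r K≤r with m≤n⇒∃[o]m+o≡n K≤r
  ... | o , refl = go o
    where
    go : ∀ o → R (orbit (K + o)) ≡ 0
    go zero    = subst (λ t → R (orbit t) ≡ 0) (sym (+-identityʳ K)) R≡0
    go (suc o) = subst (λ t → R (orbit t) ≡ 0) (sym (+-suc K o))
                   (trans (cong R (R≡0⇒downs≡0 (go o))) R-zero)

  orbit-suc : ∀ r → orbit (suc r) ≡ iterate downs n r
  orbit-suc r = trans (iterate-is-fold (suc n) downs (suc r)) (cong (λ y → iterate downs y r) downs-top)

  sumBelow-orbit : ∀ L → sumBelow (suc L) (R ∘ orbit) ≡ (n + d) + sumBelow L (R ∘ iterate downs n)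
  sumBelow-orbit L = cong₂ _+_ (cong₂ _+_ downs-top flats-top) (sumBelow-cong L (λ r _ → cong R (orbit-suc r)))

  itc-stops : Σ ℕ (λ K → ITCStopsAt c K × (∀ m → suc n ≤ m → itcWeight c K ≡ sumBelow m (R ∘ orbit)))
  itc-stops with leastWitness (λ t → R (orbit (suc t)) ≡ 0) (λ t → R (orbit (suc t)) ≟ 0) n
                              (R-orbit-vanishes (suc n) ≤-refl)
  ... | t , R≡0 , t≤n , earlier = suc t , (s≤s z≤n , stops , unstable-before) , weight
    where
    stops : Stable (itcConf c (suc t))
    stops = subst Stable (sym (proj₁ (itcConf-orbit (suc t)))) (R≡0⇒stable (orbit (suc t)) R≡0)
    unstable-before : ∀ i → 1 ≤ i → i < suc t → ¬ Stable (itcConf c i)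
    unstable-before (suc i) _ (s≤s i<t) st =
      earlier i i<t (stable⇒R≡0 (orbit (suc i)) (subst Stable (proj₁ (itcConf-orbit (suc i))) st))
    weight : ∀ m → suc n ≤ m → itcWeight c (suc t) ≡ sumBelow m (R ∘ orbit)
    weight m le = begin
      itcWeight c (suc t)                                   ≡⟨ +-identityʳ _ ⟨
      itcWeight c (suc t) + 0                               ≡⟨ cong (itcWeight c (suc t) +_) (*-zeroʳ (suc t)) ⟨
      itcWeight c (suc t) + suc t * 0                       ≡⟨ cong (λ r → itcWeight c (suc t) + suc t * r) R≡0 ⟨
      itcWeight c (suc t) + suc t * R (orbit (suc t))       ≡⟨ itcWeight-orbit (suc t) ⟩
      sumBelow (suc t) (R ∘ orbit)                          ≡⟨ sumBelow-truncate (suc t) m (R ∘ orbit)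
                                                                 (R-orbit-stays-0 (suc t) R≡0) (≤-trans (s≤s t≤n) le) ⟨
      sumBelow m (R ∘ orbit)                                ∎
      where open ≡-Reasoning

module _ {n d : ℕ} (p : List Step) (sch : Schroder n d p) where

  #U-μ≡ : #U (μ p) ≡ n
  #U-μ≡ = trans (#U-μ p) (proj₁ (proj₂ sch))

  #D-μ≡ : #D (μ p) ≡ n
  #D-μ≡ = trans (#D-μ p) (proj₁ sch)

  #H-μ≡ : #H (μ p) ≡ d
  #H-μ≡ = trans (#H-μ p) (proj₁ (proj₂ (proj₂ sch)))

  μ-above : All Above (entries (μ p))
  μ-above = entries-μ-above p (proj₂ (proj₂ (proj₂ sch))) (trans (proj₁ sch) (sym (proj₁ (proj₂ sch))))

countB-phiA : (P : ℕ → Bool) (p : List Step) →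
  countB P (phiA p) ≡ countB (λ e → isDᵉ e ∧ P ((uBefore e + hBefore e) ∸ 1)) (entries (μ p))
countB-phiA P p = begin
  countB P (phiA p)  ≡⟨ countB≡sum P (phiA p) ⟩
  sum (map (bit ∘ P) (phiA p))  ≡⟨ sum-phiA (bit ∘ P) p ⟩
  sum (map _ (suffixEntries p))  ≡⟨ sum-entries-μ _ p ⟩
  sum (map _ (entries (μ p)))  ≡⟨ sum-map-if-bit isDᵉ _ (entries (μ p)) ⟩
  countB (λ e → isDᵉ e ∧ P ((uBefore e + hBefore e) ∸ 1)) (entries (μ p)) ∎
  where open ≡-Reasoning

countB-phiB : (P : ℕ → Bool) (p : List Step) →
  countB P (phiB p) ≡ countB (λ e → isHᵉ e ∧ P (uBefore e)) (entries (μ p))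
countB-phiB P p = begin
  countB P (phiB p)  ≡⟨ countB≡sum P (phiB p) ⟩
  sum (map (bit ∘ P) (phiB p))  ≡⟨ sum-phiB (bit ∘ P) p ⟩
  sum (map _ (suffixEntries p))  ≡⟨ sum-entries-μ _ p ⟩
  sum (map _ (entries (μ p)))  ≡⟨ sum-map-if-bit isHᵉ _ (entries (μ p)) ⟩
  countB (λ e → isHᵉ e ∧ P (uBefore e)) (entries (μ p)) ∎
  where open ≡-Reasoning

mirrorProfile : ∀ {n d} (c : Cfg n d) p → Schroder n d p → φ p ≡ (toList (proj₁ c) , toList (proj₂ c)) →
                ThresholdProfile c
mirrorProfile {n} {d} (a , b) p sch eφ = record
  { downs        = #D-before w
  ; flats        = #H-before w
  ; clique-count = clique-count
  ; indep-count  = indep-count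
  ; downs-suc≤   = #D-before-suc≤ w (μ-above p sch)
  ; downs-zero   = #D-before-zero w
  ; flats-zero   = #H-before-zero w
  ; flats-mono   = #H-before-mono w
  ; downs-top    = trans (cong (λ t → #D-before w (suc t)) (sym (#U-μ≡ p sch)))
                         (trans (countB-before-top w isD) (#D-μ≡ p sch))
  ; flats-top    = trans (cong (λ t → #H-before w (suc t)) (sym (#U-μ≡ p sch)))
                         (trans (countB-before-top w isH) (#H-μ≡ p sch))
  }
  where
  open ≡-Reasoning
  w = μ p
  -- A D entry of w is preceded by at least one U step, so the truncated subtraction in φ is exact.
  pred-height : ∀ t e → Above e →
                isDᵉ e ∧ (t ≤ᵇ suc ((uBefore e + hBefore e) ∸ 1)) ≡ isDᵉ e ∧ (t ≤ᵇ uBefore e + hBefore e)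
  pred-height t (U , _)         _ = refl
  pred-height t (H , _)         _ = refl
  pred-height t (D , suc u , _) _ = refl
  clique-count : ∀ z → countFin (λ i → z + #H-before w z ≤ᵇ suc (lookup a i)) + #D-before w z ≡ n
  clique-count z = begin
    countFin (λ i → t ≤ᵇ suc (lookup a i)) + #D-before w z
      ≡⟨ cong (_+ #D-before w z) (countFin-lookup (λ x → t ≤ᵇ suc x) a) ⟩
    countB (λ x → t ≤ᵇ suc x) (toList a) + #D-before w z
      ≡⟨ cong (λ l → countB (λ x → t ≤ᵇ suc x) l + #D-before w z) (cong proj₁ eφ) ⟨
    countB (λ x → t ≤ᵇ suc x) (phiA p) + #D-before w z
      ≡⟨ cong (_+ #D-before w z) (countB-phiA (λ x → t ≤ᵇ suc x) p) ⟩
    countB (λ e → isDᵉ e ∧ (t ≤ᵇ suc ((uBefore e + hBefore e) ∸ 1))) (entries w) + #D-before w z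
      ≡⟨ cong (_+ #D-before w z) (countB-cong-local (All.map (pred-height t _) (μ-above p sch))) ⟩
    countB (λ e → isDᵉ e ∧ (t ≤ᵇ uBefore e + hBefore e)) (entries w) + #D-before w z
      ≡⟨ cong (_+ #D-before w z) (downs-above-height w z) ⟩
    countB (isDᵉ after z) (entries w) + #D-before w z
      ≡⟨ countB-after+before isDᵉ z (entries w) ⟩
    countB isDᵉ (entries w)
      ≡⟨ countB-annot-stepOf isD 0 0 0 w ⟩
    #D w
      ≡⟨ #D-μ≡ p sch ⟩
    n ∎
    where t = z + #H-before w z
  indep-count : ∀ z → countFin (λ j → z ≤ᵇ lookup b j) + #H-before w z ≡ d
  indep-count z = begin
    countFin (λ j → z ≤ᵇ lookup b j) + #H-before w z
      ≡⟨ cong (_+ #H-before w z) (countFin-lookup (z ≤ᵇ_) b) ⟩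
    countB (z ≤ᵇ_) (toList b) + #H-before w z
      ≡⟨ cong (λ l → countB (z ≤ᵇ_) l + #H-before w z) (cong proj₂ eφ) ⟨
    countB (z ≤ᵇ_) (phiB p) + #H-before w z
      ≡⟨ cong (_+ #H-before w z) (countB-phiB (z ≤ᵇ_) p) ⟩
    countB (isHᵉ after z) (entries w) + #H-before w z
      ≡⟨ countB-after+before isHᵉ z (entries w) ⟩
    countB isHᵉ (entries w)
      ≡⟨ countB-annot-stepOf isH 0 0 0 w ⟩
    #H w
      ≡⟨ #H-μ≡ p sch ⟩
    d ∎

-- X z is the x-coordinate of the top of the z-th U step of Cp.
sum-bounceHeights : (Cp : List Step) (X : ℕ → ℕ) (N : ℕ) → (∀ y → 1 ≤ y → y ≤ N → xTopU 0 0 y Cp ≡ X y) →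
  (∀ y → X (suc y) ≤ y) → X 0 ≡ 0 → (g g′ : ℕ → ℕ) → (∀ y → 1 ≤ y → y ≤ N → g y ≡ g′ y) → g′ 0 ≡ 0 →
  ∀ f y → y ≤ N → sum (map g (bounceHeights Cp f y)) ≡ sumBelow f (g′ ∘ iterate X y)
sum-bounceHeights Cp X N xTop X< X0 g g′ g≡ g′0 zero    y       _ = refl
sum-bounceHeights Cp X N xTop X< X0 g g′ g≡ g′0 (suc f) zero    _ =
  sym (sumBelow-zero (suc f) _ (λ r → trans (cong g′ (iterate-fixed X X0 r)) g′0))
sum-bounceHeights Cp X N xTop X< X0 g g′ g≡ g′0 (suc f) (suc y) y≤ =
  cong₂ _+_ (g≡ (suc y) (s≤s z≤n) y≤)
    (trans (cong (λ t → sum (map g (bounceHeights Cp f t))) (xTop (suc y) (s≤s z≤n) y≤))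
           (sum-bounceHeights Cp X N xTop X< X0 g g′ g≡ g′0 f (X (suc y)) (≤-trans (X< y) (≤-trans (n≤1+n y) y≤))))

module _ (w : List Step) (n : ℕ) (#U≡n : #U w ≡ n) (above : All Above (entries w)) where

  private
    xTop : ∀ y → 1 ≤ y → y ≤ n → xTopU 0 0 y (dyck w) ≡ #D-before w y
    xTop y 1≤y y≤n = xTopU≡#D-before w y 1≤y (subst (y ≤_) (sym #U≡n) y≤n)

    sum-heights : (g g′ : ℕ → ℕ) → (∀ y → 1 ≤ y → y ≤ n → g y ≡ g′ y) → g′ 0 ≡ 0 →
                  sum (map g (peakHeightsC w)) ≡ sumBelow (length w) (g′ ∘ iterate (#D-before w) n)
    sum-heights g g′ g≡ g′0 =
      trans (cong (λ t → sum (map g (bounceHeights (dyck w) (length w) t))) #U≡n)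
        (sum-bounceHeights (dyck w) (#D-before w) n xTop (#D-before-suc≤ w above) (#D-before-zero w)
          g g′ g≡ g′0 (length w) n ≤-refl)

  bounceC≡ : bounceC w ≡ sumBelow (length w) (#D-before w ∘ iterate (#D-before w) n)
  bounceC≡ = sum-heights _ (#D-before w) xTop (#D-before-zero w)

  -- Exchanging the two sums in Σ_α b(α) counts, for each peak, the H steps below it.
  sumB≡ : sumB w ≡ sumBelow (length w) (#H-before w ∘ iterate (#D-before w) n)
  sumB≡ = begin
    sumB w
      ≡⟨ cong sum (map-cong per-entry (entries w)) ⟩
    sum (map (λ e → sum (map (flatBelow e) (peakHeightsC w))) (entries w))
      ≡⟨ sum-map-swap flatBelow (entries w) (peakHeightsC w) ⟩
    sum (map (λ y → sum (map (λ e → flatBelow e y) (entries w))) (peakHeightsC w))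
      ≡⟨ cong sum (map-cong (λ y → sym (countB≡sum _ (entries w))) (peakHeightsC w)) ⟩
    sum (map flatsBelowPeak (peakHeightsC w))
      ≡⟨ sum-heights flatsBelowPeak (#H-before w) (λ y _ y≤n → flatsBelowPeak≡ y y≤n) (#H-before-zero w) ⟩
    sumBelow (length w) (#H-before w ∘ iterate (#D-before w) n) ∎
    where
    open ≡-Reasoning
    flatBelow : Entry → ℕ → ℕ
    flatBelow e y = bit (isHᵉ e ∧ (suc (uBefore e + hBefore e) ≤ᵇ y + hBeforeU 0 0 y w))
    flatsBelowPeak : ℕ → ℕ
    flatsBelowPeak y = countB (λ e → isHᵉ e ∧ (suc (uBefore e + hBefore e) ≤ᵇ y + hBeforeU 0 0 y w)) (entries w)
    flatsBelowPeak≡ : ∀ y → y ≤ n → flatsBelowPeak y ≡ #H-before w y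
    flatsBelowPeak≡ y y≤n = trans
      (countB-cong (λ e → cong (λ t → isHᵉ e ∧ (suc (uBefore e + hBefore e) ≤ᵇ y + t))
                               (hBeforeU≡#H-before w y (subst (y ≤_) (sym #U≡n) y≤n))) (entries w))
      (flats-below-height w y)
    per-entry : ∀ e → _ ≡ sum (map (flatBelow e) (peakHeightsC w))
    per-entry (H , u , _ , h) =
      trans (countB-map (λ py → suc (u + h) ≤ᵇ py) (λ y → y + hBeforeU 0 0 y w) (peakHeightsC w))
            (countB≡sum _ (peakHeightsC w))
    per-entry (U , _)         = sym (sum-map-zero (peakHeightsC w))
    per-entry (D , _)         = sym (sum-map-zero (peakHeightsC w))

  bounceSch≡ : bounceSch w ≡ sumBelow (length w) ((λ y → #D-before w y + #H-before w y) ∘ iterate (#D-before w) n)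
  bounceSch≡ = trans (cong₂ _+_ bounceC≡ sumB≡) (sumBelow-+ (length w) _ _)

suc-height≤ : ∀ u h d (xs : List Step) → suc (u + h) ≤ u + h + d + suc (length xs)
suc-height≤ u h d xs = ≤-trans (s≤s (m≤m+n (u + h) (d + length xs))) (≤-reflexive (rearrange u h d (length xs)))
  where
  rearrange : ∀ u h d l → suc (u + h + (d + l)) ≡ u + h + d + suc l
  rearrange = solve-∀

countB-interval : ∀ a y m → countB (λ j → (a ≤ᵇ j) ∧ (suc j ≤ᵇ y)) (upTo m) ≡ (y ⊓ m) ∸ a
countB-interval a y zero = sym (trans (cong (_∸ a) (⊓-zeroʳ y)) (0∸n≡0 a))
countB-interval a y (suc m) = begin
  countB P (upTo (suc m))                 ≡⟨ cong (countB P) (upTo-∷ʳ m) ⟨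
  countB P (upTo m ++ m ∷ [])            ≡⟨ countB-++ P (upTo m) (m ∷ []) ⟩
  countB P (upTo m) + (bit (P m) + 0)     ≡⟨ cong₂ _+_ (countB-interval a y m) (+-identityʳ (bit (P m))) ⟩
  (y ⊓ m) ∸ a + bit (P m)                 ≡⟨ last (m <? y) ⟩
  (y ⊓ suc m) ∸ a                         ∎
  where
  open ≡-Reasoning
  P : ℕ → Bool
  P j = (a ≤ᵇ j) ∧ (suc j ≤ᵇ y)
  last : Dec (m < y) → (y ⊓ m) ∸ a + bit (P m) ≡ (y ⊓ suc m) ∸ a
  last (yes m<y) rewrite m≥n⇒m⊓n≡n (≤-trans (n≤1+n m) m<y) | m≥n⇒m⊓n≡n m<y | ≤ᵇ-true m<y with a ≤? m
  ... | yes a≤m rewrite ≤ᵇ-true a≤m = trans (sym (+-∸-comm 1 a≤m)) (cong (_∸ a) (+-comm m 1))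
  ... | no  a≰m rewrite ≤ᵇ-false a≰m =
    trans (+-identityʳ _) (trans (m≤n⇒m∸n≡0 (≤-trans (n≤1+n m) (≰⇒> a≰m))) (sym (m≤n⇒m∸n≡0 (≰⇒> a≰m))))
  last (no m≮y) rewrite m≤n⇒m⊓n≡m (≮⇒≥ m≮y) | m≤n⇒m⊓n≡m (≤-trans (≮⇒≥ m≮y) (n≤1+n m))
                      | ≤ᵇ-false m≮y | ∧-zeroʳ (a ≤ᵇ m) = +-identityʳ _

countB-interval-≤ : ∀ a y m → y ≤ m → countB (λ j → (a ≤ᵇ j) ∧ (suc j ≤ᵇ y)) (upTo m) ≡ y ∸ a
countB-interval-≤ a y m y≤m = trans (countB-interval a y m) (cong (_∸ a) (m≤n⇒m⊓n≡m y≤m))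

≤ᵇ-suc : ∀ j y → (j ≤ᵇ y) ≡ (suc j ≤ᵇ suc y)
≤ᵇ-suc zero    y = refl
≤ᵇ-suc (suc j) y = refl

annot-height< : ∀ xs u d h → All (λ e → suc (uBefore e + hBefore e) ≤ u + h + d + length xs) (annot u d h xs)
annot-height< []       u d h = []
annot-height< (U ∷ xs) u d h =
  suc-height≤ u h d xs ∷ All.map (λ le → ≤-trans le (≤-reflexive (shiftU u h d _))) (annot-height< xs (suc u) d h)
  where
  shiftU : ∀ u h d l → suc u + h + d + l ≡ u + h + d + suc l
  shiftU = solve-∀
annot-height< (D ∷ xs) u d h =
  suc-height≤ u h d xs ∷ All.map (λ le → ≤-trans le (≤-reflexive (shiftD u h d _))) (annot-height< xs u (suc d) h)
  where
  shiftD : ∀ u h d l → u + h + suc d + l ≡ u + h + d + suc l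
  shiftD = solve-∀
annot-height< (H ∷ xs) u d h =
  suc-height≤ u h d xs ∷ All.map (λ le → ≤-trans le (≤-reflexive (shiftH u h d _))) (annot-height< xs u d (suc h))
  where
  shiftH : ∀ u h d l → u + suc h + d + l ≡ u + h + d + suc l
  shiftH = solve-∀

areaOf : Entry → ℕ
areaOf (U , _)          = 0
areaOf (D , u , dd , h) = u ∸ suc dd
areaOf (H , u , dd , h) = u ∸ dd

-- Its sum over the entries is the height of the minimal recurrent configuration.
offsetOf : Entry → ℕ
offsetOf (U , _)          = 0
offsetOf (D , u , dd , h) = h + dd
offsetOf (H , u , dd , h) = dd

-- The values a_j + 1 = u + h (D entries) and b_i = u (H entries) of φ, read on the mirror.
heightOf : Entry → ℕ
heightOf e = (if isDᵉ e then (uBefore e + hBefore e) ∸ 1 else 0) + (if isHᵉ e then uBefore e else 0)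

column : ℕ → Entry → ℕ
column L (s , u , dd , h) = countB (triInCol s (dd + h) (u + h)) (upTo (suc L))

column≡areaOf : ∀ L e → Above e → suc (uBefore e + hBefore e) ≤ suc L → column L e ≡ areaOf e
column≡areaOf L (U , u , dd , h) _ _ = countB-false (upTo (suc L))
column≡areaOf L (D , u , dd , h) _ le =
  trans (countB-interval-≤ (suc (dd + h)) (u + h) (suc L) (≤-trans (n≤1+n _) le))
        (trans (cong₂ _∸_ (+-comm u h) (+-comm (suc dd) h)) ([m+n]∸[m+o]≡n∸o h u (suc dd)))
column≡areaOf L (H , u , dd , h) _ le =
  trans (countB-cong (λ j → cong ((suc (dd + h) ≤ᵇ j) ∧_) (≤ᵇ-suc j (u + h))) (upTo (suc L)))
    (trans (countB-interval-≤ (suc (dd + h)) (suc (u + h)) (suc L) le)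
      (trans (cong₂ _∸_ (+-comm u h) (+-comm dd h)) ([m+n]∸[m+o]≡n∸o h u dd)))

heightOf≡areaOf+offsetOf : ∀ e → Above e → heightOf e ≡ areaOf e + offsetOf e
heightOf≡areaOf+offsetOf (U , u , dd , h) _ = refl
heightOf≡areaOf+offsetOf (D , suc u , dd , h) (s≤s dd<u) = begin
  u + h + 0                 ≡⟨ +-identityʳ _ ⟩
  u + h                     ≡⟨ cong (_+ h) (m∸n+n≡m dd<u) ⟨
  (u ∸ dd) + dd + h         ≡⟨ rearrange (u ∸ dd) dd h ⟩
  (u ∸ dd) + (h + dd)       ∎
  where
  open ≡-Reasoning
  rearrange : ∀ a b c → a + b + c ≡ a + (c + b)
  rearrange = solve-∀
heightOf≡areaOf+offsetOf (H , u , dd , h) dd≤u = sym (m∸n+n≡m dd≤u)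

tri : ℕ → ℕ
tri k = k C 2

tri-suc : ∀ k → tri (suc k) ≡ tri k + k
tri-suc k = trans (sym (nCk+nC[k+1]≡[n+1]C[k+1] k 1)) (trans (cong (_+ tri k) (nC1≡n k)) (+-comm k (tri k)))

sum-offsetOf-annot : ∀ xs u d h →
  sum (map offsetOf (annot u d h xs)) + tri (h + #H xs) + tri (d + h) ≡ tri (d + h + #D xs + #H xs) + tri h
sum-offsetOf-annot [] u d h = begin
  tri (h + 0) + tri (d + h)      ≡⟨ cong (λ t → tri t + tri (d + h)) (+-identityʳ h) ⟩
  tri h + tri (d + h)            ≡⟨ +-comm (tri h) (tri (d + h)) ⟩
  tri (d + h) + tri h            ≡⟨ cong (λ t → tri t + tri h) (trans (+-identityʳ (d + h + 0)) (+-identityʳ (d + h))) ⟨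
  tri (d + h + 0 + 0) + tri h    ∎
  where open ≡-Reasoning
sum-offsetOf-annot (U ∷ xs) u d h = sum-offsetOf-annot xs (suc u) d h
sum-offsetOf-annot (D ∷ xs) u d h = +-cancelʳ-≡ (d + h) _ _ (begin
  (h + d + E) + tri (h + H′) + tri (d + h) + (d + h)
    ≡⟨ rearrange h d E (tri (h + H′)) (tri (d + h)) ⟩
  (E + tri (h + H′) + (tri (d + h) + (d + h))) + (d + h)
    ≡⟨ cong (λ t → (E + tri (h + H′) + t) + (d + h)) (tri-suc (d + h)) ⟨
  (E + tri (h + H′) + tri (suc d + h)) + (d + h)
    ≡⟨ cong (_+ (d + h)) (sum-offsetOf-annot xs u (suc d) h) ⟩
  tri (suc d + h + D′ + H′) + tri h + (d + h)
    ≡⟨ cong (λ t → tri t + tri h + (d + h)) (shift d h D′ H′) ⟩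
  tri (d + h + suc D′ + H′) + tri h + (d + h) ∎)
  where
  open ≡-Reasoning
  E  = sum (map offsetOf (annot u (suc d) h xs))
  H′ = #H xs
  D′ = #D xs
  rearrange : ∀ h d e a b → (h + d + e) + a + b + (d + h) ≡ (e + a + (b + (d + h))) + (d + h)
  rearrange = solve-∀
  shift : ∀ d h D H → suc d + h + D + H ≡ d + h + suc D + H
  shift = solve-∀
sum-offsetOf-annot (H ∷ xs) u d h = +-cancelʳ-≡ (d + h + h) _ _ (begin
  (d + E) + tri (h + suc H′) + tri (d + h) + (d + h + h)
    ≡⟨ cong (λ t → (d + E) + tri t + tri (d + h) + (d + h + h)) (+-suc h H′) ⟩
  (d + E) + tri (suc h + H′) + tri (d + h) + (d + h + h)
    ≡⟨ rearrange d h E (tri (suc h + H′)) (tri (d + h)) ⟩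
  (E + tri (suc h + H′) + (tri (d + h) + (d + h))) + (d + h)
    ≡⟨ cong (λ t → (E + tri (suc h + H′) + t) + (d + h)) (trans (cong tri (+-suc d h)) (tri-suc (d + h))) ⟨
  (E + tri (suc h + H′) + tri (d + suc h)) + (d + h)
    ≡⟨ cong (_+ (d + h)) (sum-offsetOf-annot xs u d (suc h)) ⟩
  tri (d + suc h + D′ + H′) + tri (suc h) + (d + h)
    ≡⟨ cong₂ (λ t s → tri t + s + (d + h)) (shift d h D′ H′) (tri-suc h) ⟩
  tri (d + h + D′ + suc H′) + (tri h + h) + (d + h)
    ≡⟨ regroup (tri (d + h + D′ + suc H′)) (tri h) h d ⟩
  tri (d + h + D′ + suc H′) + tri h + (d + h + h) ∎)
  where
  open ≡-Reasoning
  E  = sum (map offsetOf (annot u d (suc h) xs))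
  H′ = #H xs
  D′ = #D xs
  rearrange : ∀ d h e a b → (d + e) + a + b + (d + h + h) ≡ (e + a + (b + (d + h))) + (d + h)
  rearrange = solve-∀
  shift : ∀ d h D H → d + suc h + D + H ≡ d + h + D + suc H
  shift = solve-∀
  regroup : ∀ t a h d → t + (a + h) + (d + h) ≡ t + a + (d + h + h)
  regroup = solve-∀

sum-offsetOf : ∀ w → sum (map offsetOf (entries w)) + tri (#H w) ≡ tri (#D w + #H w)
sum-offsetOf w = trans (sym (+-identityʳ _)) (trans (sum-offsetOf-annot w 0 0 0) (+-identityʳ _))

area≡sum-areaOf : ∀ w → All Above (entries w) → area w ≡ sum (map areaOf (entries w))
area≡sum-areaOf w above = cong sum (map-cong-local
  (All.zipWith (λ (a , le) → column≡areaOf (length w) _ a (≤-trans le (n≤1+n _))) (above , annot-height< w 0 0 0)))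

height≡sum-heightOf : ∀ {n d} (c : Cfg n d) p → φ p ≡ (toList (proj₁ c) , toList (proj₂ c)) →
                      height c ≡ sum (map heightOf (entries (μ p)))
height≡sum-heightOf (a , b) p eφ = begin
  V.sum a + V.sum b
    ≡⟨ cong₂ _+_ (sum-toList a) (sum-toList b) ⟩
  sum (toList a) + sum (toList b)
    ≡⟨ cong₂ (λ x y → sum x + sum y) (cong proj₁ eφ) (cong proj₂ eφ) ⟨
  sum (phiA p) + sum (phiB p)
    ≡⟨ cong₂ (λ x y → sum x + sum y) (map-id (phiA p)) (map-id (phiB p)) ⟨
  sum (map (λ x → x) (phiA p)) + sum (map (λ x → x) (phiB p))
    ≡⟨ cong₂ _+_ (trans (sum-phiA (λ x → x) p) (sum-entries-μ _ p))
                 (trans (sum-phiB (λ x → x) p) (sum-entries-μ _ p)) ⟩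
  sum (map _ (entries (μ p))) + sum (map _ (entries (μ p)))
    ≡⟨ sum-map-+ _ _ (entries (μ p)) ⟩
  sum (map heightOf (entries (μ p))) ∎
  where
  open ≡-Reasoning
  sum-toList : ∀ {m} (v : Vec ℕ m) → V.sum v ≡ sum (toList v)
  sum-toList V.[]       = refl
  sum-toList (x V.∷ v) = cong (x +_) (sum-toList v)

+-difference : ∀ a b x y → a + x ≡ b + y → ℤ.+ a ≡ ℤ.+ b ℤ.- (ℤ.+ x ℤ.- ℤ.+ y)
+-difference a b x y e = begin
  ℤ.+ a                            ≡⟨ cancel (ℤ.+ a) (ℤ.+ x) ⟩
  (ℤ.+ a ℤ.+ ℤ.+ x) ℤ.- ℤ.+ x      ≡⟨ cong (ℤ._- ℤ.+ x) (pos-+ a x) ⟨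
  ℤ.+ (a + x) ℤ.- ℤ.+ x            ≡⟨ cong (λ t → ℤ.+ t ℤ.- ℤ.+ x) e ⟩
  ℤ.+ (b + y) ℤ.- ℤ.+ x            ≡⟨ cong (ℤ._- ℤ.+ x) (pos-+ b y) ⟩
  (ℤ.+ b ℤ.+ ℤ.+ y) ℤ.- ℤ.+ x      ≡⟨ regroup (ℤ.+ b) (ℤ.+ x) (ℤ.+ y) ⟩
  ℤ.+ b ℤ.- (ℤ.+ x ℤ.- ℤ.+ y)      ∎
  where
  open ≡-Reasoning
  cancel : ∀ a x → a ≡ (a ℤ.+ x) ℤ.- x
  cancel = ℤ-Solver.solve-∀
  regroup : ∀ b x y → (b ℤ.+ y) ℤ.- x ≡ b ℤ.- (x ℤ.- y)
  regroup = ℤ-Solver.solve-∀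

area-μ≡level : ∀ {n d} (c : Cfg n d) p → Schroder n d p → φ p ≡ (toList (proj₁ c) , toList (proj₂ c)) →
               ℤ.+ area (μ p) ≡ level c
area-μ≡level {n} {d} c p sch eφ = +-difference (area w) (height c) (tri (n + d)) (tri d) (begin
  area w + tri (n + d)
    ≡⟨ cong (λ t → area w + tri t) (cong₂ _+_ (#D-μ≡ p sch) (#H-μ≡ p sch)) ⟨
  area w + tri (#D w + #H w)
    ≡⟨ cong (area w +_) (sum-offsetOf w) ⟨
  area w + (offsets + tri (#H w))
    ≡⟨ +-assoc (area w) offsets _ ⟨
  area w + offsets + tri (#H w)
    ≡⟨ cong₂ _+_ area+offsets≡height (cong tri (#H-μ≡ p sch)) ⟩
  height c + tri d ∎)
  where
  open ≡-Reasoning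
  w = μ p
  offsets = sum (map offsetOf (entries w))
  area+offsets≡height : area w + offsets ≡ height c
  area+offsets≡height = begin
    area w + offsets
      ≡⟨ cong (_+ offsets) (area≡sum-areaOf w (μ-above p sch)) ⟩
    sum (map areaOf (entries w)) + offsets
      ≡⟨ sum-map-+ areaOf offsetOf (entries w) ⟩
    sum (map (λ e → areaOf e + offsetOf e) (entries w))
      ≡⟨ cong sum (map-cong-local (All.map (λ {e} → sym ∘ heightOf≡areaOf+offsetOf e) (μ-above p sch))) ⟩
    sum (map heightOf (entries w))
      ≡⟨ height≡sum-heightOf c p eφ ⟨
    height c ∎

itc-stops-with-bounce : ∀ {n d} (c : Cfg n d) → Stable c → ∀ p → Schroder n d p →
  φ p ≡ (toList (proj₁ c) , toList (proj₂ c)) →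
  Σ ℕ (λ k → ITCStopsAt c k × (bounceSch (μ p) + (n + d) ≡ itcWeight c k))
itc-stops-with-bounce {n} {d} c stable p sch eφ = proj₁ itc-stops , proj₁ (proj₂ itc-stops) , (begin
  bounceSch w + (n + d)
    ≡⟨ +-comm _ (n + d) ⟩
  (n + d) + bounceSch w
    ≡⟨ cong (n + d +_) (bounceSch≡ w n (#U-μ≡ p sch) (μ-above p sch)) ⟩
  (n + d) + sumBelow (length w) (R ∘ iterate downs n)
    ≡⟨ sumBelow-orbit (length w) ⟨
  sumBelow (suc (length w)) (R ∘ orbit)
    ≡⟨ proj₂ (proj₂ itc-stops) (suc (length w)) (s≤s (subst (_≤ length w) (#U-μ≡ p sch) (countB-≤-length isU w))) ⟨
  itcWeight c (proj₁ itc-stops) ∎)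
  where
  open ≡-Reasoning
  open ITCOrbit c stable (mirrorProfile c p sch eφ)
  open ThresholdProfile (mirrorProfile c p sch eφ) using (downs)
  w = μ p

-- Imported only now: with +_ in scope, sections such as (a +_) above would be ambiguous.
open import Data.Integer using (+_)

theorem3p4 : (n d : ℕ) → 1 ≤ n → (c : Cfg n d) → SortedRec c →
    (p : List Step) → Schroder n d p →
    φ p ≡ (toList (proj₁ c) , toList (proj₂ c)) →
      (+ area (μ p) ≡ level c)
      × Σ ℕ (λ k → ITCStopsAt c k × (bounceSch (μ p) + (n + d) ≡ itcWeight c k))
theorem3p4 n d _ c ((stable , _) , _) p sch eφ = area-μ≡level c p sch eφ , itc-stops-with-bounce c stable p sch eφ
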